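{- Fix integers $n\ge 1$ and $0\le m\le N$, where $N=\binom{n}{2}$, and let $G,H$ be $n$-vertex graphs with $m$ edges. Put $X=X_G-X_H$. If $\Delta_kX=0$ for some integer $k\ge 0$, then $\Delta_iX=0$ for all integers $i\ge k$.
   Context: All graphs are simple, undirected, with $n$ vertices. $U_m$ denotes the set of all unlabelled $n$-vertex graphs with exactly $m$ edges. For a graph $G$ with $m$ edges, $X_G$ is the column vector indexed by $U_m$ with entry $1$ at the isomorphism class of $G$ and $0$ elsewhere. For an integer $j\ge 0$, $\Delta_j$ is the square matrix with rows and columns indexed by $U_m$ whose $(k,l)$-entry is the number of ways to obtain a graph isomorphic to $G_k\in U_m$ from $G_l\in U_m$ by removing a set $A$ of $j$ edges of $G_l$ and then adding a set of $j$ edges not present in $G_l-A$ (the added edges need not be different from the removed ones). Thus $\Delta_jX_G$ is the modified $j$-deck of $G$. -}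

module Defs where

open import Data.Nat using (ℕ; zero; suc; _<ᵇ_)
open import Data.Bool using (Bool; true; false; _∧_; _∨_; not; if_then_else_)
open import Data.Fin using (Fin; toℕ; _≟_)
open import Data.Product using (_×_; _,_)
open import Data.List using (List; []; _∷_; map; _++_; concatMap; filterᵇ; length; allFin)
open import Data.Bool.ListAction using (any; all)
open import Relation.Binary.PropositionalEquality using (_≡_)
open import Data.Vec using (Vec; lookup) renaming ([] to []ᵥ; _∷_ to _∷ᵥ_)
open import Data.Integer using (ℤ; +_; _-_)
open import Relation.Nullary.Decidable using (⌊_⌋)

-- A (labelled) graph on vertex set Fin n.  Only the values G i j with
-- toℕ i < toℕ j are ever read (via 'edge'), so the graph is simple:
-- undirected and loopless.
Graph : ℕ → Set
Graph n = Fin n → Fin n → Bool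

edge : ∀ {n} → Graph n → Fin n → Fin n → Bool
edge G i j =
  if toℕ i <ᵇ toℕ j then G i j
  else (if toℕ j <ᵇ toℕ i then G j i else false)

Pair : ℕ → Set
Pair n = Fin n × Fin n

pairs : (n : ℕ) → List (Pair n)
pairs n = concatMap (λ i → map (λ j → (i , j)) (filterᵇ (λ j → toℕ i <ᵇ toℕ j) (allFin n))) (allFin n)

edgeP : ∀ {n} → Graph n → Pair n → Bool
edgeP G (i , j) = edge G i j

edges : ∀ {n} → Graph n → List (Pair n)
edges {n} G = filterᵇ (edgeP G) (pairs n)

nonEdges : ∀ {n} → Graph n → List (Pair n)
nonEdges {n} G = filterᵇ (λ p → not (edgeP G p)) (pairs n)

numEdges : ∀ {n} → Graph n → ℕ
numEdges G = length (edges G)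

choose : ∀ {a} {A : Set a} → ℕ → List A → List (List A)
choose zero xs = [] ∷ []
choose (suc k) [] = []
choose (suc k) (x ∷ xs) = map (x ∷_) (choose k xs) ++ choose (suc k) xs

eqPair : ∀ {n} → Pair n → Pair n → Bool
eqPair (i , j) (k , l) = ⌊ i ≟ k ⌋ ∧ ⌊ j ≟ l ⌋

memB : ∀ {n} → Pair n → List (Pair n) → Bool
memB p S = any (eqPair p) S

-- G - A  and  G + B  for sets A, B of (ordered, i<j) pairs
removeE : ∀ {n} → Graph n → List (Pair n) → Graph n
removeE G A i j = edge G i j ∧ not (memB (i , j) A)

addE : ∀ {n} → Graph n → List (Pair n) → Graph n
addE G B i j = edge G i j ∨ memB (i , j) B

allVecs : (n k : ℕ) → List (Vec (Fin n) k)
allVecs n zero = []ᵥ ∷ []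
allVecs n (suc k) = concatMap (λ x → map (x ∷ᵥ_) (allVecs n k)) (allFin n)

injB : ∀ {n} → Vec (Fin n) n → Bool
injB {n} σ = all (λ { (i , j) → not ⌊ lookup σ i ≟ lookup σ j ⌋ }) (pairs n)

preservesB : ∀ {n} → Vec (Fin n) n → Graph n → Graph n → Bool
preservesB {n} σ G K =
  all (λ { (i , j) → if edge G i j then edge K (lookup σ i) (lookup σ j)
                                    else not (edge K (lookup σ i) (lookup σ j)) }) (pairs n)

isoB : ∀ {n} → Graph n → Graph n → Bool
isoB {n} G K = any (λ σ → injB σ ∧ preservesB σ G K) (allVecs n n)

ways : ∀ {n} → ℕ → Graph n → List (List (Pair n) × List (Pair n))
ways j L = concatMap (λ A → map (λ B → (A , B)) (choose j (nonEdges (removeE L A)))) (choose j (edges L))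

countB : ∀ {a} {A : Set a} → (A → Bool) → List A → ℕ
countB p xs = length (filterᵇ p xs)

-- (Δ_j)_{[K],[L]} : number of ways to obtain a graph isomorphic to K from L
-- by removing a j-set A of edges of L and adding a j-set of edges not in L - A
Δentry : ∀ {n} → ℕ → Graph n → Graph n → ℕ
Δentry j K L = countB (λ { (A , B) → isoB (addE (removeE L A) B) K }) (ways j L)

-- the entry at the class [K] of the vector Δ_j X with X = X_G - X_H
-- (by linearity, (Δ_j X_G)_[K] = (Δ_j)_{[K],[G]})
ΔX : ∀ {n} → ℕ → Graph n → Graph n → Graph n → ℤ
ΔX j G H K = + Δentry j K G - + Δentry j K H

-- a vector indexed by U_m (given by its entries at the classes [K], K with m edges) is zero
VanishesOn : ∀ {n} → ℕ → (Graph n → ℤ) → Set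
VanishesOn {n} m v = (K : Graph n) → numEdges K ≡ m → v K ≡ + 0

-- Work with labelled edge sets on the vertex set Fin n. For an m-edge graph X let a_X be the
-- number of labelled copies of X and P_X(s) the number of those containing the edge set s.
-- Sorting the exchanges counted by Δⱼ by the set s of kept edges gives
--   a_X · (Δⱼ)_{Y,X} = Σ_{|s| = m−j} P_X(s) P_Y(s),
-- so Δⱼ is a Gram matrix up to the diagonal factor a. With x = a_H P_G and y = a_G P_H,
-- Δₖ(X_G − X_H) = 0 becomes Σ_{|s| = m−k} 2xy = Σ_{|s| = m−k} (x² + y²), which forces x = y on
-- every (m−k)-set (AM–GM). Every (m−i)-set with i ≥ k lies in C(i, i−k) sets of size m−k inside
-- each copy containing it, so x = y also holds on (m−i)-sets, and the Gram identity for Δᵢ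
-- turns this back into Δᵢ(X_G − X_H) = 0.

module Submission where

open import Algebra.Properties.CommutativeSemigroup using (interchange)
open import Data.Bool using (Bool; true; false; _∧_; _∨_; not; _xor_; if_then_else_; T)
open import Data.Bool.ListAction using (all; any; and)
open import Data.Bool.Properties using (xor-comm; ∧-identityʳ)
open import Data.Fin using (Fin; toℕ; _≟_; punchOut)
open import Data.Fin.Properties using (<-cmp; <⇒≢; any?; pigeonhole; punchOut-injective)
import Data.Integer as ℤ
import Data.Integer.Properties as ℤ
open import Data.List using (List; []; _∷_; map; _++_; length; filterᵇ; allFin; concatMap)
open import Data.List.Membership.Propositional using (_∈_; _∉_)
open import Data.List.Membership.Propositional.Properties
  using (∈-allFin; ∈-++⁻; ∈-map⁺; ∈-map⁻; ∈-filter⁺; ∈-filter⁻; ∈-concatMap⁺; ∈-concatMap⁻)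
open import Data.List.Membership.Propositional.Properties.WithK using (unique∧set⇒bag)
open import Data.List.Properties using (filter-++; map-++; length-++; length-map; map-∘; map-cong; map-cong-local)
open import Data.List.Relation.Binary.BagAndSetEquality using (∼bag⇒↭)
open import Data.List.Relation.Binary.Permutation.Propositional using (_↭_; refl; prep; swap; trans; ↭-sym)
open import Data.List.Relation.Binary.Permutation.Propositional.Properties using (∈-resp-↭; ↭-length; filter-↭)
open import Data.List.Relation.Unary.All as All using (All; []; _∷_)
open import Data.List.Relation.Unary.All.Properties using (All¬⇒¬Any; map⁺)
open import Data.List.Relation.Unary.AllPairs as AllPairs using ([]; _∷_)
import Data.List.Relation.Unary.AllPairs.Properties as AllPairs
open import Data.List.Relation.Unary.Any as Any using (here; there)
open import Data.List.Relation.Unary.Unique.Propositional using (Unique)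
import Data.List.Relation.Unary.Unique.Propositional.Properties as Unique
open import Data.Nat using (ℕ; zero; suc; _+_; _*_; _≤_; _<_; _∸_; _≡ᵇ_; _<ᵇ_; ∣_-_∣; z≤n; s≤s; >-nonZero)
open import Data.Nat.Combinatorics using (_C_; nCk+nC[k+1]≡[n+1]C[k+1])
open import Data.Nat.ListAction using (sum)
open import Data.Nat.ListAction.Properties using (sum-++)
open import Data.Nat.Properties
  using ( +-identityʳ; *-identityˡ; *-identityʳ; *-zeroʳ; +-comm; *-comm; +-assoc; *-assoc; +-suc
        ; *-distribˡ-+; +-cancelˡ-≡; *-cancelˡ-≡; +-cancelʳ-≤; ≤-antisym; ≤-trans; ≤-reflexive; ≤-refl
        ; ≤-total; +-monoʳ-≤; +-mono-≤; *-monoʳ-≤; *-mono-≤; m≤m+n; m≤n+m; <-≤-trans; <⇒≤; ≤⇒≯; n<1+n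
        ; m+[n∸m]≡n; m∸n+n≡m; m∸n≤m; ∣m-m+n∣≡n; ∣-∣-comm; ∣m-n∣≡0⇒m≡n; m*n≡0⇒m≡0∨n≡0
        ; <⇒<ᵇ; <ᵇ⇒<; ≡ᵇ⇒≡; +-commutativeSemigroup)
open import Data.Nat.Tactic.RingSolver using (solve-∀)
open import Data.Product using (_×_; _,_; proj₁; proj₂; ∃)
open import Data.Product.Properties using (,-injectiveˡ; ,-injectiveʳ)
open import Data.Sum using (inj₁; inj₂; reduce)
open import Data.Vec using (Vec; []; _∷_; lookup; tabulate)
open import Data.Vec.Properties using (lookup∘tabulate)
open import Function using (_∘_)
open import Function.Bundles using (mk⇔)
open import Function.Definitions using (Injective)
open import Level using (Level; _⊔_)
open import Relation.Binary.Definitions using (DecidableEquality; tri<; tri≈; tri>)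
open import Relation.Binary.PropositionalEquality
  using (_≡_; _≢_; _≗_; refl; sym; cong; cong₂; subst; module ≡-Reasoning)
  renaming (trans to ≡-trans)
open import Relation.Nullary using (¬_; yes; no; does; _because_; contradiction)
open import Relation.Nullary.Decidable using (T?; ⌊_⌋)
open import Relation.Nullary.Reflects using (Reflects; ofʸ; ofⁿ)

open import Defs

private variable
  ℓ ℓ′ : Level
  A    : Set ℓ
  B    : Set ℓ′
  n    : ℕ

[_] : Bool → ℕ
[ true ]  = 1
[ false ] = 0

≡ᵇ-sym : ∀ a b → (a ≡ᵇ b) ≡ (b ≡ᵇ a)
≡ᵇ-sym zero    zero    = refl
≡ᵇ-sym zero    (suc b) = refl
≡ᵇ-sym (suc a) zero    = refl
≡ᵇ-sym (suc a) (suc b) = ≡ᵇ-sym a b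

≡ᵇ-+ˡ : ∀ c a b → (c + a ≡ᵇ c + b) ≡ (a ≡ᵇ b)
≡ᵇ-+ˡ zero    a b = refl
≡ᵇ-+ˡ (suc c) a b = ≡ᵇ-+ˡ c a b

<ᵇ-true : ∀ {m n} → m < n → (m <ᵇ n) ≡ true
<ᵇ-true {m} {n} m<n with m <ᵇ n | <⇒<ᵇ m<n
... | true | _ = refl

<ᵇ-false : ∀ {m n} → n ≤ m → (m <ᵇ n) ≡ false
<ᵇ-false {m} {n} n≤m with m <ᵇ n in m<ᵇn
... | true  = contradiction (<ᵇ⇒< m n (subst T (sym m<ᵇn) _)) (≤⇒≯ n≤m)
... | false = refl

[]*-cong : ∀ b {x y} → (b ≡ true → x ≡ y) → [ b ] * x ≡ [ b ] * y
[]*-cong true  x≡y = cong (1 *_) (x≡y refl)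
[]*-cong false _   = refl

[]*-injective : ∀ {b x y} → b ≡ true → [ b ] * x ≡ [ b ] * y → x ≡ y
[]*-injective refl eq = ≡-trans (sym (+-identityʳ _)) (≡-trans eq (+-identityʳ _))

[∧] : ∀ a b → [ a ∧ b ] ≡ [ a ] * [ b ]
[∧] true  b = sym (+-identityʳ _)
[∧] false b = refl

≡ᵇ-refl : ∀ a → (a ≡ᵇ a) ≡ true
≡ᵇ-refl zero    = refl
≡ᵇ-refl (suc a) = ≡ᵇ-refl a

≡⇒≡ᵇ-true : ∀ {a b} → a ≡ b → (a ≡ᵇ b) ≡ true
≡⇒≡ᵇ-true {a} refl = ≡ᵇ-refl a

≡ᵇ-≡ : ∀ {a b} → (a ≡ᵇ b) ≡ true → a ≡ b
≡ᵇ-≡ {a} {b} a≡ᵇb = ≡ᵇ⇒≡ a b (subst T (sym a≡ᵇb) _)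

≡ᵇ-guard : ∀ a b (F : ℕ → ℕ) → [ a ≡ᵇ b ] * F a ≡ [ a ≡ᵇ b ] * F b
≡ᵇ-guard a b F = []*-cong (a ≡ᵇ b) (cong F ∘ ≡ᵇ-≡)

+-tight : ∀ {a b c d} → a ≤ c → b ≤ d → a + b ≡ c + d → a ≡ c × b ≡ d
+-tight {a} {b} {c} {d} a≤c b≤d eq = a≡c , +-cancelˡ-≡ a b d (≡-trans eq (cong (_+ d) (sym a≡c)))
  where
  a≡c : a ≡ c
  a≡c = ≤-antisym a≤c (+-cancelʳ-≤ d c a (≤-trans (≤-reflexive (sym eq)) (+-monoʳ-≤ a b≤d)))

squares-gap : ∀ x d → x * x + (x + d) * (x + d) ≡ 2 * (x * (x + d)) + d * d
squares-gap = solve-∀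

sum-of-squares≤ : ∀ {x y} → x ≤ y → x * x + y * y ≡ 2 * (x * y) + ∣ x - y ∣ * ∣ x - y ∣
sum-of-squares≤ {x} {y} x≤y rewrite sym (m+[n∸m]≡n x≤y) | ∣m-m+n∣≡n x (y ∸ x) = squares-gap x (y ∸ x)

sum-of-squares : ∀ x y → x * x + y * y ≡ 2 * (x * y) + ∣ x - y ∣ * ∣ x - y ∣
sum-of-squares x y with ≤-total x y
... | inj₁ x≤y = sum-of-squares≤ x≤y
... | inj₂ y≤x = begin
  x * x + y * y                       ≡⟨ +-comm (x * x) (y * y) ⟩
  y * y + x * x                       ≡⟨ sum-of-squares≤ y≤x ⟩
  2 * (y * x) + ∣ y - x ∣ * ∣ y - x ∣ ≡⟨ cong₂ (λ u v → 2 * u + v * v) (*-comm y x) (∣-∣-comm y x) ⟩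
  2 * (x * y) + ∣ x - y ∣ * ∣ x - y ∣ ∎
  where open ≡-Reasoning

am-gm : ∀ x y → 2 * (x * y) ≤ x * x + y * y
am-gm x y = subst (2 * (x * y) ≤_) (sym (sum-of-squares x y)) (m≤m+n _ _)

am-gm-equality : ∀ {x y} → 2 * (x * y) ≡ x * x + y * y → x ≡ y
am-gm-equality {x} {y} eq = ∣m-n∣≡0⇒m≡n (reduce (m*n≡0⇒m≡0∨n≡0 gap gap²≡0))
  where
  gap : ℕ
  gap = ∣ x - y ∣
  gap²≡0 : gap * gap ≡ 0
  gap²≡0 = +-cancelˡ-≡ (2 * (x * y)) (gap * gap) 0
             (≡-trans (sym (sum-of-squares x y)) (≡-trans (sym eq) (sym (+-identityʳ _))))

countB-∷ : ∀ (p : A → Bool) x xs → countB p (x ∷ xs) ≡ [ p x ] + countB p xs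
countB-∷ p x xs with p x
... | true  = refl
... | false = refl

length-choose : ∀ k (ys : List A) → length (choose k ys) ≡ length ys C k
length-choose zero    ys       = refl
length-choose (suc k) []       = refl
length-choose (suc k) (y ∷ ys) = begin
  length (map (y ∷_) (choose k ys) ++ choose (suc k) ys)
    ≡⟨ length-++ (map (y ∷_) (choose k ys)) ⟩
  length (map (y ∷_) (choose k ys)) + length (choose (suc k) ys)
    ≡⟨ cong (_+ _) (length-map (y ∷_) (choose k ys)) ⟩
  length (choose k ys) + length (choose (suc k) ys)
    ≡⟨ cong₂ _+_ (length-choose k ys) (length-choose (suc k) ys) ⟩
  length ys C k + length ys C suc k
    ≡⟨ nCk+nC[k+1]≡[n+1]C[k+1] (length ys) k ⟩
  suc (length ys) C suc k ∎
  where open ≡-Reasoning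

C-positive : ∀ {d u} → u ≤ d → 0 < d C u
C-positive {d}     {zero}  _         = s≤s z≤n
C-positive {suc d} {suc u} (s≤s u≤d) =
  subst (0 <_) (nCk+nC[k+1]≡[n+1]C[k+1] d u) (<-≤-trans (C-positive u≤d) (m≤m+n _ _))

all-cong-∈ : ∀ {xs : List A} {f g : A → Bool} →
             (∀ {p} → p ∈ xs → f p ≡ g p) → all f xs ≡ all g xs
all-cong-∈ {xs = []}     _  = refl
all-cong-∈ {xs = x ∷ xs} eq = cong₂ _∧_ (eq (here refl)) (all-cong-∈ (eq ∘ there))

all-elim : ∀ {xs : List A} {f : A → Bool} → all f xs ≡ true → ∀ {p} → p ∈ xs → f p ≡ true
all-elim {xs = x ∷ xs} {f} all≡true (here refl) with f x
... | true = refl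
all-elim {xs = x ∷ xs} {f} all≡true (there p∈xs) with f x
... | true = all-elim all≡true p∈xs

all-intro : ∀ {xs : List A} {f : A → Bool} → (∀ {p} → p ∈ xs → f p ≡ true) → all f xs ≡ true
all-intro {xs = []}     _      = refl
all-intro {xs = x ∷ xs} f≡true = cong₂ _∧_ (f≡true (here refl)) (all-intro (f≡true ∘ there))

all-∧ : ∀ (xs : List A) (f g : A → Bool) → all (λ p → f p ∧ g p) xs ≡ all f xs ∧ all g xs
all-∧ []       f g = refl
all-∧ (x ∷ xs) f g rewrite all-∧ xs f g with f x | g x | all f xs
... | true  | true  | _     = refl
... | true  | false | true  = refl
... | true  | false | false = refl
... | false | _     | _     = refl

countB-cong-∈ : ∀ {xs : List A} {f g : A → Bool} →
                (∀ {p} → p ∈ xs → f p ≡ g p) → countB f xs ≡ countB g xs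
countB-cong-∈ {xs = []}     _  = refl
countB-cong-∈ {xs = x ∷ xs} {f} {g} eq = begin
  countB f (x ∷ xs)    ≡⟨ countB-∷ f x xs ⟩
  [ f x ] + countB f xs ≡⟨ cong₂ (λ b n → [ b ] + n) (eq (here refl)) (countB-cong-∈ (eq ∘ there)) ⟩
  [ g x ] + countB g xs ≡⟨ sym (countB-∷ g x xs) ⟩
  countB g (x ∷ xs)    ∎
  where open ≡-Reasoning

sum-map-cong-∈ : ∀ {xs : List A} {f g : A → ℕ} →
                 (∀ {x} → x ∈ xs → f x ≡ g x) → sum (map f xs) ≡ sum (map g xs)
sum-map-cong-∈ eq = cong sum (map-cong-local (All.tabulate eq))

sum-map-const-1 : ∀ (xs : List A) → sum (map (λ _ → 1) xs) ≡ length xs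
sum-map-const-1 []       = refl
sum-map-const-1 (x ∷ xs) = cong suc (sum-map-const-1 xs)

∈-choose : ∀ k (ys : List A) {B p} → B ∈ choose k ys → p ∈ B → p ∈ ys
∈-choose zero    ys       (here refl) ()
∈-choose (suc k) (y ∷ ys) B∈ p∈ with ∈-++⁻ (map (y ∷_) (choose k ys)) B∈
... | inj₂ B∈′ = there (∈-choose (suc k) ys B∈′ p∈)
... | inj₁ B∈′ with ∈-map⁻ (y ∷_) B∈′ | p∈
...   | _ , _   , refl | here p≡y   = here p≡y
...   | _ , B′∈ , refl | there p∈B′ = there (∈-choose k ys B′∈ p∈B′)

any-intro : ∀ {xs : List A} (f : A → Bool) {x} → x ∈ xs → f x ≡ true → any f xs ≡ true
any-intro f {x} (here refl) fx≡true rewrite fx≡true = refl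
any-intro {xs = y ∷ xs} f (there x∈xs) fx≡true with f y
... | true  = refl
... | false = any-intro f x∈xs fx≡true

any-elim : ∀ (xs : List A) (f : A → Bool) → any f xs ≡ true → ∃ λ x → x ∈ xs × f x ≡ true
any-elim (y ∷ xs) f any≡true with f y in fy
... | true  = y , here refl , fy
... | false with any-elim xs f any≡true
...   | x , x∈xs , fx = x , there x∈xs , fx

all-↭ : ∀ (f : A → Bool) {xs ys} → xs ↭ ys → all f xs ≡ all f ys
all-↭ f refl          = refl
all-↭ f (prep x π)    = cong (f x ∧_) (all-↭ f π)
all-↭ f (swap x y π)  = ≡-trans (cong (λ b → f x ∧ (f y ∧ b)) (all-↭ f π)) (∧-swap (f x) (f y) _)
  where
  ∧-swap : ∀ a b c → a ∧ (b ∧ c) ≡ b ∧ (a ∧ c)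
  ∧-swap true  b     c = refl
  ∧-swap false true  c = refl
  ∧-swap false false c = refl
all-↭ f (trans π ρ)   = ≡-trans (all-↭ f π) (all-↭ f ρ)

countB-↭ : ∀ (f : A → Bool) {xs ys} → xs ↭ ys → countB f xs ≡ countB f ys
countB-↭ f π = ↭-length (filter-↭ (T? ∘ f) π)

countB-map : ∀ (f : B → Bool) (τ : A → B) xs → countB f (map τ xs) ≡ countB (f ∘ τ) xs
countB-map f τ []       = refl
countB-map f τ (x ∷ xs) = ≡-trans (countB-∷ f (τ x) (map τ xs))
                         (≡-trans (cong ([ f (τ x) ] +_) (countB-map f τ xs)) (sym (countB-∷ (f ∘ τ) x xs)))

countB-as-sum : ∀ (f : A → Bool) xs → countB f xs ≡ sum (map (λ x → [ f x ]) xs)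
countB-as-sum f []       = refl
countB-as-sum f (x ∷ xs) = ≡-trans (countB-∷ f x xs) (cong ([ f x ] +_) (countB-as-sum f xs))

countB-concatMap : ∀ (f : B → Bool) (g : A → List B) xs →
                   countB f (concatMap g xs) ≡ sum (map (λ x → countB f (g x)) xs)
countB-concatMap f g []       = refl
countB-concatMap f g (x ∷ xs) =
  ≡-trans (≡-trans (cong length (filter-++ (T? ∘ f) (g x) (concatMap g xs))) (length-++ (filterᵇ f (g x))))
          (cong (countB f (g x) +_) (countB-concatMap f g xs))

unique-map : ∀ (τ : A → B) {xs} → (∀ {p q} → p ∈ xs → q ∈ xs → τ p ≡ τ q → p ≡ q) →
             Unique xs → Unique (map τ xs)
unique-map τ inj []              = []
unique-map τ inj (x≢xs ∷ uniq) =
  map⁺ (All.tabulate (λ {y} y∈ τx≡τy → All.lookup x≢xs y∈ (inj (here refl) (there y∈) τx≡τy)))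
  ∷ unique-map τ (λ p∈ q∈ → inj (there p∈) (there q∈)) uniq

-- Sums over the subsets of a list

module SubsetSums {ℓ} {A : Set ℓ} (_≟_ : DecidableEquality A) where

  Subset : Set ℓ
  Subset = A → Bool

  ∅ : Subset
  ∅ _ = false

  _[_]≔_ : Subset → A → Bool → Subset
  (s [ x ]≔ b) p = if does (p ≟ x) then b else s p

  ⟦_⟧ : List A → Subset
  ⟦ ys ⟧ p = any (λ y → does (p ≟ y)) ys

  _∪_ _∖_ _⊕_ : Subset → Subset → Subset
  (s ∪ t) p = s p ∨ t p
  (s ∖ t) p = s p ∧ not (t p)
  (s ⊕ t) p = s p xor t p

  _⊆⟨_⟩_ : Subset → List A → Subset → Bool
  s ⊆⟨ xs ⟩ t = all (λ p → not (s p) ∨ t p) xs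

  _≐⟨_⟩_ : Subset → List A → Subset → Set ℓ
  s ≐⟨ xs ⟩ t = ∀ {p} → p ∈ xs → s p ≡ t p

  -- Subsets of xs are represented by their indicators, which are false outside xs.
  ∑ : List A → (Subset → ℕ) → ℕ
  ∑ []       h = h ∅
  ∑ (x ∷ xs) h = ∑ xs (λ s → h (s [ x ]≔ true)) + ∑ xs (λ s → h (s [ x ]≔ false))

  infix 5 ∑
  syntax ∑ xs (λ s → e) = ∑[ s ⊆ xs ] e

  -- Only the values on xs of an indicator are meaningful, so functions summed over the
  -- subsets of xs are required to be local to xs.
  Local : ∀ {ℓ′} {B : Set ℓ′} → List A → (Subset → B) → Set (ℓ ⊔ ℓ′)
  Local xs h = ∀ {s t} → s ≐⟨ xs ⟩ t → h s ≡ h t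

  private variable
    x  : A
    xs : List A
    b  : Bool

  update-same : ∀ s x b → (s [ x ]≔ b) x ≡ b
  update-same s x b with x ≟ x
  ... | yes _   = refl
  ... | no x≢x = contradiction refl x≢x

  update-other : ∀ s {x p} b → p ≢ x → (s [ x ]≔ b) p ≡ s p
  update-other s {x} {p} b p≢x with p ≟ x
  ... | yes p≡x = contradiction p≡x p≢x
  ... | no _    = refl

  update-self : ∀ s x → (s [ x ]≔ s x) ≗ s
  update-self s x p with p ≟ x
  ... | yes refl = refl
  ... | no _     = refl

  update-fresh : ∀ {x xs} s b → x ∉ xs → (s [ x ]≔ b) ≐⟨ xs ⟩ s
  update-fresh s b x∉xs p∈xs = update-other s b (λ { refl → x∉xs p∈xs })

  local⇒cong : {h : Subset → B} → Local xs h → ∀ {s t} → s ≗ t → h s ≡ h t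
  local⇒cong lh s≗t = lh (λ {p} _ → s≗t p)

  update-local : {h : Subset → B} → Local (x ∷ xs) h → Local xs (λ s → h (s [ x ]≔ b))
  update-local {x = x} {xs = xs} {b = b} lh {s} {t} s≐t = lh agree
    where
    agree : (s [ x ]≔ b) ≐⟨ x ∷ xs ⟩ (t [ x ]≔ b)
    agree {p} p∈ with p ≟ x | p∈
    ... | yes _    | _          = refl
    ... | no p≢x   | here p≡x   = contradiction p≡x p≢x
    ... | no _     | there p∈xs = s≐t p∈xs

  countB-local : Local xs (λ s → countB s xs)
  countB-local s≐t = countB-cong-∈ s≐t

  ⊆-localˡ : ∀ t → Local xs (λ s → s ⊆⟨ xs ⟩ t)
  ⊆-localˡ t s≐s′ = all-cong-∈ (λ p∈ → cong (λ u → not u ∨ t _) (s≐s′ p∈))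

  ⊆-localʳ : ∀ s → Local xs (λ t → s ⊆⟨ xs ⟩ t)
  ⊆-localʳ s t≐t′ = all-cong-∈ (λ p∈ → cong (not (s _) ∨_) (t≐t′ p∈))

  countB-fresh : x ∉ xs → ∀ s b → countB (s [ x ]≔ b) (x ∷ xs) ≡ [ b ] + countB s xs
  countB-fresh {x} {xs} x∉xs s b = ≡-trans (countB-∷ (s [ x ]≔ b) x xs)
    (cong₂ (λ u n → [ u ] + n) (update-same s x b) (countB-local (update-fresh s b x∉xs)))

  ⊆-fresh : x ∉ xs → ∀ s b t → (s [ x ]≔ b) ⊆⟨ x ∷ xs ⟩ t ≡ (not b ∨ t x) ∧ (s ⊆⟨ xs ⟩ t)
  ⊆-fresh {x} {xs} x∉xs s b t =
    cong₂ (λ u v → (not u ∨ t x) ∧ v) (update-same s x b) (⊆-localˡ t (update-fresh s b x∉xs))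

  ∑-cong : ∀ xs {h h′ : Subset → ℕ} → (∀ s → h s ≡ h′ s) → ∑ xs h ≡ ∑ xs h′
  ∑-cong []       eq = eq ∅
  ∑-cong (x ∷ xs) eq = cong₂ _+_ (∑-cong xs (λ _ → eq _)) (∑-cong xs (λ _ → eq _))

  ∑-zero : ∀ xs → ∑[ s ⊆ xs ] 0 ≡ 0
  ∑-zero []       = refl
  ∑-zero (x ∷ xs) = cong₂ _+_ (∑-zero xs) (∑-zero xs)

  ∑-distrib-+ : ∀ xs (h h′ : Subset → ℕ) → ∑[ s ⊆ xs ] (h s + h′ s) ≡ ∑ xs h + ∑ xs h′
  ∑-distrib-+ []       h h′ = refl
  ∑-distrib-+ (x ∷ xs) h h′ =
    ≡-trans (cong₂ _+_ (∑-distrib-+ xs (h ∘ _[ x ]≔ true) (h′ ∘ _[ x ]≔ true))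
                       (∑-distrib-+ xs (h ∘ _[ x ]≔ false) (h′ ∘ _[ x ]≔ false)))
            (interchange +-commutativeSemigroup (∑ xs (h ∘ _[ x ]≔ true)) (∑ xs (h′ ∘ _[ x ]≔ true))
                         (∑ xs (h ∘ _[ x ]≔ false)) (∑ xs (h′ ∘ _[ x ]≔ false)))

  *-distribˡ-∑ : ∀ xs c (h : Subset → ℕ) → ∑[ s ⊆ xs ] (c * h s) ≡ c * ∑ xs h
  *-distribˡ-∑ []       c h = refl
  *-distribˡ-∑ (x ∷ xs) c h =
    ≡-trans (cong₂ _+_ (*-distribˡ-∑ xs c _) (*-distribˡ-∑ xs c _)) (sym (*-distribˡ-+ c _ _))

  *-distribʳ-∑ : ∀ xs c (h : Subset → ℕ) → ∑[ s ⊆ xs ] (h s * c) ≡ ∑ xs h * c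
  *-distribʳ-∑ xs c h =
    ≡-trans (∑-cong xs (λ s → *-comm (h s) c)) (≡-trans (*-distribˡ-∑ xs c h) (*-comm c (∑ xs h)))

  ∑-comm : ∀ xs ys (h : Subset → Subset → ℕ) →
           ∑[ s ⊆ xs ] ∑[ t ⊆ ys ] h s t ≡ ∑[ t ⊆ ys ] ∑[ s ⊆ xs ] h s t
  ∑-comm []       ys h = refl
  ∑-comm (x ∷ xs) ys h = ≡-trans (cong₂ _+_ (∑-comm xs ys _) (∑-comm xs ys _)) (sym (∑-distrib-+ ys _ _))

  ∑-mono-≤ : ∀ xs {h h′ : Subset → ℕ} → (∀ s → h s ≤ h′ s) → ∑ xs h ≤ ∑ xs h′
  ∑-mono-≤ []       le = le ∅
  ∑-mono-≤ (x ∷ xs) le = +-mono-≤ (∑-mono-≤ xs (λ _ → le _)) (∑-mono-≤ xs (λ _ → le _))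

  term≤∑ : ∀ xs {h : Subset → ℕ} → Local xs h → ∀ s → h s ≤ ∑ xs h
  term≤∑ []       lh s = ≤-reflexive (lh (λ ()))
  term≤∑ (x ∷ xs) {h} lh s =
    ≤-trans (≤-reflexive (local⇒cong lh (λ p → sym (update-self s x p)))) (branch (s x))
    where
    branch : ∀ b → h (s [ x ]≔ b) ≤ ∑ (x ∷ xs) h
    branch true  = ≤-trans (term≤∑ xs (update-local lh) s) (m≤m+n _ _)
    branch false = ≤-trans (term≤∑ xs (update-local lh) s) (m≤n+m _ _)

  ∑-tight : ∀ xs {f g : Subset → ℕ} → Local xs f → Local xs g → (∀ s → f s ≤ g s) →
            ∑ xs f ≡ ∑ xs g → ∀ s → f s ≡ g s
  ∑-tight []       lf lg f≤g eq s = ≡-trans (lf (λ ())) (≡-trans eq (lg (λ ())))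
  ∑-tight (x ∷ xs) {f} {g} lf lg f≤g eq s =
    ≡-trans (local⇒cong lf (λ p → sym (update-self s x p)))
            (≡-trans (branch (s x)) (local⇒cong lg (update-self s x)))
    where
    halves : ∑[ s ⊆ xs ] f (s [ x ]≔ true) ≡ ∑[ s ⊆ xs ] g (s [ x ]≔ true)
           × ∑[ s ⊆ xs ] f (s [ x ]≔ false) ≡ ∑[ s ⊆ xs ] g (s [ x ]≔ false)
    halves = +-tight (∑-mono-≤ xs (λ _ → f≤g _)) (∑-mono-≤ xs (λ _ → f≤g _)) eq
    branch : ∀ b → f (s [ x ]≔ b) ≡ g (s [ x ]≔ b)
    branch true  = ∑-tight xs (update-local lf) (update-local lg) (λ _ → f≤g _) (proj₁ halves) s
    branch false = ∑-tight xs (update-local lf) (update-local lg) (λ _ → f≤g _) (proj₂ halves) s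

  ∑-⊕ : ∀ xs c {h : Subset → ℕ} → Local xs h → ∑[ s ⊆ xs ] h (s ⊕ c) ≡ ∑ xs h
  ∑-⊕ []       c lh = lh (λ ())
  ∑-⊕ (x ∷ xs) c {h} lh = ≡-trans (cong₂ _+_ (translated true) (translated false)) (reorder (c x))
    where
    update-⊕ : ∀ s b → ((s [ x ]≔ b) ⊕ c) ≗ ((s ⊕ c) [ x ]≔ (b xor c x))
    update-⊕ s b p with p ≟ x
    ... | yes refl = refl
    ... | no _     = refl
    translated : ∀ b → ∑[ s ⊆ xs ] h ((s [ x ]≔ b) ⊕ c) ≡ ∑[ s ⊆ xs ] h (s [ x ]≔ (b xor c x))
    translated b = ≡-trans (∑-cong xs (λ s → local⇒cong lh (update-⊕ s b))) (∑-⊕ xs c (update-local lh))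
    reorder : ∀ cx → (∑[ s ⊆ xs ] h (s [ x ]≔ not cx)) + (∑[ s ⊆ xs ] h (s [ x ]≔ cx)) ≡ ∑ (x ∷ xs) h
    reorder true  = +-comm (∑[ s ⊆ xs ] h (s [ x ]≔ false)) (∑[ s ⊆ xs ] h (s [ x ]≔ true))
    reorder false = refl

  ∑-↭ : ∀ {xs ys} {h : Subset → ℕ} → Local xs h → xs ↭ ys → ∑ xs h ≡ ∑ ys h
  ∑-↭ lh refl        = refl
  ∑-↭ lh (prep x p)  = cong₂ _+_ (∑-↭ (update-local lh) p) (∑-↭ (update-local lh) p)
  ∑-↭ lh (trans p q) = ≡-trans (∑-↭ lh p) (∑-↭ (λ s≐t → lh (λ p∈ → s≐t (∈-resp-↭ p p∈))) q)
  ∑-↭ {h = h} lh (swap {xs} {ys} x y p) with x ≟ y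
  ... | yes refl = cong₂ _+_ (cong₂ _+_ (inner true true) (inner true false))
                             (cong₂ _+_ (inner false true) (inner false false))
    where
    inner : ∀ a b → ∑[ s ⊆ xs ] h ((s [ x ]≔ b) [ x ]≔ a) ≡ ∑[ s ⊆ ys ] h ((s [ x ]≔ b) [ x ]≔ a)
    inner a b = ∑-↭ (update-local (update-local lh)) p
  ... | no x≢y = ≡-trans (cong₂ _+_ (cong₂ _+_ (commuted true true) (commuted true false))
                                    (cong₂ _+_ (commuted false true) (commuted false false)))
                         (interchange +-commutativeSemigroup (∑[ s ⊆ ys ] h ((s [ x ]≔ true) [ y ]≔ true))
                                      (∑[ s ⊆ ys ] h ((s [ x ]≔ true) [ y ]≔ false))
                                      (∑[ s ⊆ ys ] h ((s [ x ]≔ false) [ y ]≔ true))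
                                      (∑[ s ⊆ ys ] h ((s [ x ]≔ false) [ y ]≔ false)))
    where
    update-comm : ∀ s a b → ((s [ y ]≔ b) [ x ]≔ a) ≗ ((s [ x ]≔ a) [ y ]≔ b)
    update-comm s a b p with p ≟ x | p ≟ y
    ... | yes refl | yes refl = contradiction refl x≢y
    ... | yes refl | no _     = refl
    ... | no _     | yes refl = refl
    ... | no _     | no _     = refl
    commuted : ∀ a b → ∑[ s ⊆ xs ] h ((s [ y ]≔ b) [ x ]≔ a) ≡ ∑[ s ⊆ ys ] h ((s [ x ]≔ a) [ y ]≔ b)
    commuted a b = ≡-trans (∑-↭ (update-local (update-local lh)) p)
                           (∑-cong ys (λ s → local⇒cong lh (update-comm s a b)))

  ∑-map : ∀ (τ : A → A) xs {h : Subset → ℕ} → (∀ {p q} → p ∈ xs → q ∈ xs → τ p ≡ τ q → p ≡ q) →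
          Local xs h → ∑[ s ⊆ map τ xs ] h (s ∘ τ) ≡ ∑ xs h
  ∑-map τ []       inj lh = refl
  ∑-map τ (x ∷ xs) {h} inj lh = cong₂ _+_ (relabelled true) (relabelled false)
    where
    agree : ∀ s b → ((s [ τ x ]≔ b) ∘ τ) ≐⟨ x ∷ xs ⟩ ((s ∘ τ) [ x ]≔ b)
    agree s b {p} p∈ with p ≟ x | τ p ≟ τ x
    ... | yes _    | yes _     = refl
    ... | yes refl | no τx≢τx  = contradiction refl τx≢τx
    ... | no p≢x   | yes τp≡τx = contradiction (inj p∈ (here refl) τp≡τx) p≢x
    ... | no _     | no _      = refl
    relabelled : ∀ b → ∑[ s ⊆ map τ xs ] h ((s [ τ x ]≔ b) ∘ τ) ≡ ∑[ s ⊆ xs ] h (s [ x ]≔ b)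
    relabelled b = ≡-trans (∑-cong (map τ xs) (λ s → lh (agree s b)))
                           (∑-map τ xs (λ p∈ q∈ → inj (there p∈) (there q∈)) (update-local lh))

  ⟦∷⟧ : ∀ x ys → ⟦ x ∷ ys ⟧ ≗ (⟦ ys ⟧ [ x ]≔ true)
  ⟦∷⟧ x ys p with p ≟ x
  ... | yes _ = refl
  ... | no _  = refl

  ⟦⟧-∉ : ∀ {p} ys → p ∉ ys → ⟦ ys ⟧ p ≡ false
  ⟦⟧-∉ []           _   = refl
  ⟦⟧-∉ {p} (y ∷ ys) p∉ with p ≟ y
  ... | yes p≡y = contradiction (here p≡y) p∉
  ... | no _    = ⟦⟧-∉ ys (p∉ ∘ there)

  choose-fresh : ∀ {x ys} k {h : Subset → ℕ} → x ∉ ys → (∀ {s t} → s ≗ t → h s ≡ h t) →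
    sum (map (λ B → h ⟦ B ⟧) (choose k ys)) ≡ sum (map (λ B → h (⟦ B ⟧ [ x ]≔ false)) (choose k ys))
  choose-fresh {x} {ys} k x∉ys h-cong = sum-map-cong-∈ λ B∈ → h-cong (fresh-at B∈)
    where
    fresh-at : ∀ {B} → B ∈ choose k ys → ⟦ B ⟧ ≗ (⟦ B ⟧ [ x ]≔ false)
    fresh-at {B} B∈ p with p ≟ x
    ... | yes refl = ⟦⟧-∉ B (x∉ys ∘ ∈-choose k ys B∈)
    ... | no _     = refl

  choose-∑ : ∀ {xs} → Unique xs → ∀ (P : Subset) k {h : Subset → ℕ} → Local xs h →
    sum (map (λ B → h ⟦ B ⟧) (choose k (filterᵇ P xs)))
      ≡ ∑[ s ⊆ xs ] [ s ⊆⟨ xs ⟩ P ] * ([ countB s xs ≡ᵇ k ] * h s)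
  choose-∑ {[]}     _             P zero    lh =
    ≡-trans (+-identityʳ _) (sym (≡-trans (*-identityˡ _) (*-identityˡ _)))
  choose-∑ {[]}     _             P (suc k) lh = refl
  choose-∑ {x ∷ xs} (x≢xs ∷ uniq) P k {h} lh =
    ≡-trans (split k) (sym (cong₂ _+_ (rhs-at true) (rhs-at false)))
    where
    x∉xs : x ∉ xs
    x∉xs = All¬⇒¬Any x≢xs
    h[_] : Bool → Subset → ℕ
    h[ b ] s = h (s [ x ]≔ b)
    L R : ℕ → (Subset → ℕ) → ℕ
    L k g = sum (map (λ B → g ⟦ B ⟧) (choose k (filterᵇ P xs)))
    R k g = ∑[ s ⊆ xs ] [ s ⊆⟨ xs ⟩ P ] * ([ countB s xs ≡ᵇ k ] * g s)
    R′ : ℕ → Bool → ℕ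
    R′ k b = ∑[ s ⊆ xs ] [ (not b ∨ P x) ∧ (s ⊆⟨ xs ⟩ P) ] * ([ [ b ] + countB s xs ≡ᵇ k ] * h[ b ] s)
    rhs-at : ∀ b → ∑[ s ⊆ xs ] [ (s [ x ]≔ b) ⊆⟨ x ∷ xs ⟩ P ]
                                 * ([ countB (s [ x ]≔ b) (x ∷ xs) ≡ᵇ k ] * h[ b ] s)
                   ≡ R′ k b
    rhs-at b = ∑-cong xs (λ s → cong₂ (λ u n → [ u ] * ([ n ≡ᵇ k ] * h[ b ] s))
                                      (⊆-fresh x∉xs s b P) (countB-fresh x∉xs s b))
    IH : ∀ k b → L k h[ b ] ≡ R k h[ b ]
    IH k b = choose-∑ uniq P k (update-local lh)
    x-fresh : ∀ k → L k h ≡ L k h[ false ]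
    x-fresh k = choose-fresh k (x∉xs ∘ proj₁ ∘ ∈-filter⁻ (T? ∘ P)) (local⇒cong lh)
    vanishing : ∑[ s ⊆ xs ] [ s ⊆⟨ xs ⟩ P ] * 0 ≡ 0
    vanishing = ≡-trans (∑-cong xs (λ s → *-zeroʳ [ s ⊆⟨ xs ⟩ P ])) (∑-zero xs)
    split : ∀ k → sum (map (λ B → h ⟦ B ⟧) (choose k (filterᵇ P (x ∷ xs)))) ≡ R′ k true + R′ k false
    split k with P x
    split k       | false =
      ≡-trans (x-fresh k) (≡-trans (IH k false) (cong (_+ R k h[ false ]) (sym (∑-zero xs))))
    split zero    | true  =
      ≡-trans (x-fresh zero) (≡-trans (IH zero false) (cong (_+ R zero h[ false ]) (sym vanishing)))
    split (suc k) | true  = begin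
      sum (map g (map (x ∷_) (choose k F) ++ choose (suc k) F))
        ≡⟨ cong sum (map-++ g (map (x ∷_) (choose k F)) (choose (suc k) F)) ⟩
      sum (map g (map (x ∷_) (choose k F)) ++ map g (choose (suc k) F))
        ≡⟨ sum-++ (map g (map (x ∷_) (choose k F))) (map g (choose (suc k) F)) ⟩
      sum (map g (map (x ∷_) (choose k F))) + L (suc k) h
        ≡⟨ cong₂ _+_ (cong sum (≡-trans (sym (map-∘ (choose k F)))
                                        (map-cong (λ B → local⇒cong lh (⟦∷⟧ x B)) (choose k F))))
                     (x-fresh (suc k)) ⟩
      L k h[ true ] + L (suc k) h[ false ]
        ≡⟨ cong₂ _+_ (IH k true) (IH (suc k) false) ⟩
      R k h[ true ] + R (suc k) h[ false ] ∎
      where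
      open ≡-Reasoning
      F : List A
      F = filterᵇ P xs
      g : List A → ℕ
      g B = h ⟦ B ⟧

  count-⊕ : ∀ xs {c f} → c ⊆⟨ xs ⟩ f ≡ true → countB c xs + countB (f ⊕ c) xs ≡ countB f xs
  count-⊕ []       _ = refl
  count-⊕ (x ∷ xs) {c} {f} c⊆f
    rewrite countB-∷ c x xs | countB-∷ (f ⊕ c) x xs | countB-∷ f x xs with c x | f x
  ... | true  | true  = cong suc (count-⊕ xs c⊆f)
  ... | false | true  = ≡-trans (+-suc _ _) (cong suc (count-⊕ xs c⊆f))
  ... | false | false = count-⊕ xs c⊆f

  -- The sets f ⊇ c with |f| = |c| + j are the translates B ⊕ c of the j-subsets B of the
  -- complement of c.
  extensions-∑ : ∀ {xs} → Unique xs → ∀ c j {h : Subset → ℕ} → Local xs h →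
    sum (map (λ B → h (c ∪ ⟦ B ⟧)) (choose j (filterᵇ (not ∘ c) xs)))
      ≡ ∑[ f ⊆ xs ] [ c ⊆⟨ xs ⟩ f ] * ([ countB f xs ≡ᵇ countB c xs + j ] * h f)
  extensions-∑ {xs} uniq c j {h} lh = begin
    sum (map (λ B → h (c ∪ ⟦ B ⟧)) (choose j (filterᵇ (not ∘ c) xs)))
      ≡⟨ choose-∑ uniq (not ∘ c) j (λ s≐t → lh (λ p∈ → cong (c _ ∨_) (s≐t p∈))) ⟩
    ∑[ s ⊆ xs ] [ s ⊆⟨ xs ⟩ (not ∘ c) ] * ([ countB s xs ≡ᵇ j ] * h (c ∪ s))
      ≡⟨ sym (∑-⊕ xs c local) ⟩
    ∑[ f ⊆ xs ] [ (f ⊕ c) ⊆⟨ xs ⟩ (not ∘ c) ] * ([ countB (f ⊕ c) xs ≡ᵇ j ] * h (c ∪ (f ⊕ c)))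
      ≡⟨ ∑-cong xs summand ⟩
    ∑[ f ⊆ xs ] [ c ⊆⟨ xs ⟩ f ] * ([ countB f xs ≡ᵇ countB c xs + j ] * h f) ∎
    where
    open ≡-Reasoning
    local : Local xs (λ s → [ s ⊆⟨ xs ⟩ (not ∘ c) ] * ([ countB s xs ≡ᵇ j ] * h (c ∪ s)))
    local s≐t = cong₂ (λ u v → [ u ] * v) (⊆-localˡ (not ∘ c) s≐t)
                      (cong₂ (λ n v → [ n ≡ᵇ j ] * v) (countB-local s≐t)
                             (lh (λ p∈ → cong (c _ ∨_) (s≐t p∈))))
    disjoint⇔contains : ∀ a b → (not (a xor b) ∨ not b) ≡ (not b ∨ a)
    disjoint⇔contains true  true  = refl
    disjoint⇔contains true  false = refl
    disjoint⇔contains false true  = refl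
    disjoint⇔contains false false = refl
    refill : ∀ a b → (not b ∨ a) ≡ true → (b ∨ (a xor b)) ≡ a
    refill true  true  _ = refl
    refill true  false _ = refl
    refill false false _ = refl
    summand : ∀ f → [ (f ⊕ c) ⊆⟨ xs ⟩ (not ∘ c) ] * ([ countB (f ⊕ c) xs ≡ᵇ j ] * h (c ∪ (f ⊕ c)))
                  ≡ [ c ⊆⟨ xs ⟩ f ] * ([ countB f xs ≡ᵇ countB c xs + j ] * h f)
    summand f = ≡-trans (cong (λ u → [ u ] * ([ countB (f ⊕ c) xs ≡ᵇ j ] * h (c ∪ (f ⊕ c))))
                              (all-cong-∈ {xs = xs} (λ {p} _ → disjoint⇔contains (f p) (c p))))
                        ([]*-cong (c ⊆⟨ xs ⟩ f) λ c⊆f →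
                          cong₂ (λ b n → [ b ] * n) (size c⊆f)
                                (lh (λ {p} p∈ → refill (f p) (c p) (all-elim c⊆f p∈))))
      where
      size : c ⊆⟨ xs ⟩ f ≡ true → (countB (f ⊕ c) xs ≡ᵇ j) ≡ (countB f xs ≡ᵇ countB c xs + j)
      size c⊆f = ≡-trans (sym (≡ᵇ-+ˡ (countB c xs) _ j)) (cong (_≡ᵇ countB c xs + j) (count-⊕ xs c⊆f))

  -- The subsets s ⊆ g with |s| + j = |g| are the translates A ⊕ g of the j-subsets A of g.
  removals-∑ : ∀ {xs} → Unique xs → ∀ g j {h : Subset → ℕ} → Local xs h →
    sum (map (λ B → h (g ∖ ⟦ B ⟧)) (choose j (filterᵇ g xs)))
      ≡ ∑[ s ⊆ xs ] [ s ⊆⟨ xs ⟩ g ] * ([ countB s xs + j ≡ᵇ countB g xs ] * h s)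
  removals-∑ {xs} uniq g j {h} lh = begin
    sum (map (λ B → h (g ∖ ⟦ B ⟧)) (choose j (filterᵇ g xs)))
      ≡⟨ choose-∑ uniq g j (λ s≐t → lh (λ p∈ → cong (λ u → g _ ∧ not u) (s≐t p∈))) ⟩
    ∑[ a ⊆ xs ] [ a ⊆⟨ xs ⟩ g ] * ([ countB a xs ≡ᵇ j ] * h (g ∖ a))
      ≡⟨ sym (∑-⊕ xs g local) ⟩
    ∑[ s ⊆ xs ] [ (s ⊕ g) ⊆⟨ xs ⟩ g ] * ([ countB (s ⊕ g) xs ≡ᵇ j ] * h (g ∖ (s ⊕ g)))
      ≡⟨ ∑-cong xs summand ⟩
    ∑[ s ⊆ xs ] [ s ⊆⟨ xs ⟩ g ] * ([ countB s xs + j ≡ᵇ countB g xs ] * h s) ∎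
    where
    open ≡-Reasoning
    local : Local xs (λ a → [ a ⊆⟨ xs ⟩ g ] * ([ countB a xs ≡ᵇ j ] * h (g ∖ a)))
    local a≐b = cong₂ (λ u v → [ u ] * v) (⊆-localˡ g a≐b)
                      (cong₂ (λ n v → [ n ≡ᵇ j ] * v) (countB-local a≐b)
                             (lh (λ p∈ → cong (λ u → g _ ∧ not u) (a≐b p∈))))
    ⊕-contained : ∀ a b → (not (a xor b) ∨ b) ≡ (not a ∨ b)
    ⊕-contained true  true  = refl
    ⊕-contained true  false = refl
    ⊕-contained false true  = refl
    ⊕-contained false false = refl
    remainder : ∀ a b → (not a ∨ b) ≡ true → (b ∧ not (a xor b)) ≡ a
    remainder true  true  _ = refl
    remainder false true  _ = refl
    remainder false false _ = refl
    summand : ∀ s → [ (s ⊕ g) ⊆⟨ xs ⟩ g ] * ([ countB (s ⊕ g) xs ≡ᵇ j ] * h (g ∖ (s ⊕ g)))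
                  ≡ [ s ⊆⟨ xs ⟩ g ] * ([ countB s xs + j ≡ᵇ countB g xs ] * h s)
    summand s = ≡-trans (cong (λ u → [ u ] * ([ countB (s ⊕ g) xs ≡ᵇ j ] * h (g ∖ (s ⊕ g))))
                              (all-cong-∈ {xs = xs} (λ {p} _ → ⊕-contained (s p) (g p))))
                        ([]*-cong (s ⊆⟨ xs ⟩ g) λ s⊆g →
                          cong₂ (λ b n → [ b ] * n) (size s⊆g)
                                (lh (λ {p} p∈ → remainder (s p) (g p) (all-elim s⊆g p∈))))
      where
      size : s ⊆⟨ xs ⟩ g ≡ true → (countB (s ⊕ g) xs ≡ᵇ j) ≡ (countB s xs + j ≡ᵇ countB g xs)
      size s⊆g = begin
          (countB (s ⊕ g) xs ≡ᵇ j)                   ≡⟨ sym (≡ᵇ-+ˡ (countB s xs) _ j) ⟩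
          (countB s xs + countB (s ⊕ g) xs ≡ᵇ countB s xs + j)
            ≡⟨ cong (λ n → countB s xs + n ≡ᵇ countB s xs + j)
                    (countB-cong-∈ {xs = xs} (λ {p} _ → xor-comm (s p) (g p))) ⟩
          (countB s xs + countB (g ⊕ s) xs ≡ᵇ countB s xs + j)
            ≡⟨ cong (_≡ᵇ countB s xs + j) (count-⊕ xs s⊆g) ⟩
          (countB g xs ≡ᵇ countB s xs + j)          ≡⟨ ≡ᵇ-sym (countB g xs) _ ⟩
          (countB s xs + j ≡ᵇ countB g xs)          ∎

  ∑-size≡C : ∀ {xs} → Unique xs → ∀ P u →
             ∑[ t ⊆ xs ] [ t ⊆⟨ xs ⟩ P ] * [ countB t xs ≡ᵇ u ] ≡ countB P xs C u
  ∑-size≡C {xs} uniq P u = begin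
    ∑[ t ⊆ xs ] [ t ⊆⟨ xs ⟩ P ] * [ countB t xs ≡ᵇ u ]
      ≡⟨ ∑-cong xs (λ t → cong ([ t ⊆⟨ xs ⟩ P ] *_) (sym (*-identityʳ _))) ⟩
    ∑[ t ⊆ xs ] [ t ⊆⟨ xs ⟩ P ] * ([ countB t xs ≡ᵇ u ] * 1)
      ≡⟨ sym (choose-∑ uniq P u (λ _ → refl)) ⟩
    sum (map (λ _ → 1) (choose u (filterᵇ P xs)))
      ≡⟨ sum-map-const-1 (choose u (filterᵇ P xs)) ⟩
    length (choose u (filterᵇ P xs))
      ≡⟨ length-choose u (filterᵇ P xs) ⟩
    countB P xs C u ∎
    where open ≡-Reasoning

  ⊆-trans : ∀ {xs r s e} → r ⊆⟨ xs ⟩ s ≡ true → s ⊆⟨ xs ⟩ e ≡ true → r ⊆⟨ xs ⟩ e ≡ true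
  ⊆-trans {xs} {r} {s} {e} r⊆s s⊆e =
    all-intro {xs = xs} λ {p} p∈ → chain (r p) (s p) (e p) (all-elim r⊆s p∈) (all-elim s⊆e p∈)
    where
    chain : ∀ a b c → (not a ∨ b) ≡ true → (not b ∨ c) ≡ true → (not a ∨ c) ≡ true
    chain true  true  true  _ _ = refl
    chain false _     _     _ _ = refl

  between-⊕ : ∀ xs {r e} t → r ⊆⟨ xs ⟩ e ≡ true →
              (r ⊆⟨ xs ⟩ (t ⊕ r) ∧ (t ⊕ r) ⊆⟨ xs ⟩ e) ≡ t ⊆⟨ xs ⟩ (e ⊕ r)
  between-⊕ xs {r} {e} t r⊆e = begin
    r ⊆⟨ xs ⟩ (t ⊕ r) ∧ (t ⊕ r) ⊆⟨ xs ⟩ e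
      ≡⟨ sym (all-∧ xs _ _) ⟩
    all (λ p → (not (r p) ∨ (t p xor r p)) ∧ (not (t p xor r p) ∨ e p)) xs
      ≡⟨ all-cong-∈ {xs = xs} (λ {p} _ → pointwise (t p) (r p) (e p)) ⟩
    all (λ p → (not (t p) ∨ (e p xor r p)) ∧ (not (r p) ∨ e p)) xs
      ≡⟨ all-∧ xs _ _ ⟩
    t ⊆⟨ xs ⟩ (e ⊕ r) ∧ r ⊆⟨ xs ⟩ e
      ≡⟨ cong (t ⊆⟨ xs ⟩ (e ⊕ r) ∧_) r⊆e ⟩
    t ⊆⟨ xs ⟩ (e ⊕ r) ∧ true
      ≡⟨ ∧-identityʳ _ ⟩
    t ⊆⟨ xs ⟩ (e ⊕ r) ∎
    where
    open ≡-Reasoning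
    pointwise : ∀ t r e → ((not r ∨ (t xor r)) ∧ (not (t xor r) ∨ e)) ≡ ((not t ∨ (e xor r)) ∧ (not r ∨ e))
    pointwise true  true  true  = refl
    pointwise true  true  false = refl
    pointwise true  false true  = refl
    pointwise true  false false = refl
    pointwise false true  true  = refl
    pointwise false true  false = refl
    pointwise false false true  = refl
    pointwise false false false = refl

  count-⊕-disjoint : ∀ xs {r e t} → r ⊆⟨ xs ⟩ e ≡ true → t ⊆⟨ xs ⟩ (e ⊕ r) ≡ true →
                     countB (t ⊕ r) xs ≡ countB r xs + countB t xs
  count-⊕-disjoint xs {r} {e} {t} r⊆e t⊆e⊕r = begin
    countB (t ⊕ r) xs
      ≡⟨ sym (count-⊕ xs r⊆t⊕r) ⟩
    countB r xs + countB ((t ⊕ r) ⊕ r) xs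
      ≡⟨ cong (countB r xs +_) (countB-cong-∈ {xs = xs} (λ {p} _ → cancel (t p) (r p))) ⟩
    countB r xs + countB t xs ∎
    where
    open ≡-Reasoning
    disjoint : ∀ t r e → (not t ∨ (e xor r)) ≡ true → (not r ∨ e) ≡ true → (not r ∨ (t xor r)) ≡ true
    disjoint true  true  true  () _
    disjoint true  true  false _  ()
    disjoint true  false _     _ _ = refl
    disjoint false true  true  _ _ = refl
    disjoint false false _     _ _ = refl
    cancel : ∀ t r → ((t xor r) xor r) ≡ t
    cancel true  true  = refl
    cancel true  false = refl
    cancel false true  = refl
    cancel false false = refl
    r⊆t⊕r : r ⊆⟨ xs ⟩ (t ⊕ r) ≡ true
    r⊆t⊕r = all-intro {xs = xs} λ {p} p∈ →
      disjoint (t p) (r p) (e p) (all-elim t⊆e⊕r p∈) (all-elim r⊆e p∈)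

  ∑-interval : ∀ {xs} → Unique xs → ∀ {r e} d u → countB r xs + d ≡ countB e xs →
    ∑[ s ⊆ xs ] [ r ⊆⟨ xs ⟩ s ∧ s ⊆⟨ xs ⟩ e ] * [ countB s xs ≡ᵇ countB r xs + u ]
      ≡ [ r ⊆⟨ xs ⟩ e ] * (d C u)
  ∑-interval {xs} uniq {r} {e} d u |r|+d≡|e| with r ⊆⟨ xs ⟩ e in r⊆e
  ... | false = ≡-trans (∑-cong xs (λ s → cong (λ b → [ b ] * _) (empty s))) (∑-zero xs)
    where
    empty : ∀ s → (r ⊆⟨ xs ⟩ s ∧ s ⊆⟨ xs ⟩ e) ≡ false
    empty s with r ⊆⟨ xs ⟩ s in r⊆s | s ⊆⟨ xs ⟩ e in s⊆e
    ... | true  | true  = contradiction (≡-trans (sym r⊆e) (⊆-trans {xs} {r} {s} {e} r⊆s s⊆e)) λ ()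
    ... | true  | false = refl
    ... | false | _     = refl
  ... | true = begin
    ∑[ s ⊆ xs ] [ r ⊆⟨ xs ⟩ s ∧ s ⊆⟨ xs ⟩ e ] * [ countB s xs ≡ᵇ countB r xs + u ]
      ≡⟨ sym (∑-⊕ xs r local) ⟩
    ∑[ t ⊆ xs ] [ r ⊆⟨ xs ⟩ (t ⊕ r) ∧ (t ⊕ r) ⊆⟨ xs ⟩ e ] * [ countB (t ⊕ r) xs ≡ᵇ countB r xs + u ]
      ≡⟨ ∑-cong xs summand ⟩
    ∑[ t ⊆ xs ] [ t ⊆⟨ xs ⟩ (e ⊕ r) ] * [ countB t xs ≡ᵇ u ]
      ≡⟨ ∑-size≡C uniq (e ⊕ r) u ⟩
    countB (e ⊕ r) xs C u
      ≡⟨ cong (_C u) (+-cancelˡ-≡ (countB r xs) _ _ (≡-trans (count-⊕ xs r⊆e) (sym |r|+d≡|e|))) ⟩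
    d C u
      ≡⟨ sym (+-identityʳ _) ⟩
    1 * (d C u) ∎
    where
    open ≡-Reasoning
    local : Local xs (λ s → [ r ⊆⟨ xs ⟩ s ∧ s ⊆⟨ xs ⟩ e ] * [ countB s xs ≡ᵇ countB r xs + u ])
    local s≐t = cong₂ (λ u v → [ u ] * v) (cong₂ _∧_ (⊆-localʳ r s≐t) (⊆-localˡ e s≐t))
                      (cong (λ n → [ n ≡ᵇ countB r xs + u ]) (countB-local s≐t))
    summand : ∀ t → [ r ⊆⟨ xs ⟩ (t ⊕ r) ∧ (t ⊕ r) ⊆⟨ xs ⟩ e ]
                      * [ countB (t ⊕ r) xs ≡ᵇ countB r xs + u ]
                  ≡ [ t ⊆⟨ xs ⟩ (e ⊕ r) ] * [ countB t xs ≡ᵇ u ]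
    summand t = ≡-trans (cong (λ b → [ b ] * [ countB (t ⊕ r) xs ≡ᵇ countB r xs + u ]) (between-⊕ xs t r⊆e))
                        ([]*-cong (t ⊆⟨ xs ⟩ (e ⊕ r)) λ t⊆e⊕r →
                          cong [_] (≡-trans (cong (_≡ᵇ countB r xs + u) (count-⊕-disjoint xs r⊆e t⊆e⊕r))
                                            (≡ᵇ-+ˡ (countB r xs) (countB t xs) u)))

-- Vertex pairs and relabelling

pair-reflects : (i k j l : Fin n) → Reflects ((i , j) ≡ (k , l)) (⌊ i ≟ k ⌋ ∧ ⌊ j ≟ l ⌋)
pair-reflects i k j l with i ≟ k | j ≟ l
... | yes refl | yes refl = ofʸ refl
... | yes _    | no j≢l   = ofⁿ (j≢l ∘ ,-injectiveʳ)
... | no i≢k   | _        = ofⁿ (i≢k ∘ ,-injectiveˡ)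

-- Its Boolean part is literally eqPair, so ⟦ A ⟧ p computes memB p A.
_≟ₚ_ : DecidableEquality (Pair n)
(i , j) ≟ₚ (k , l) = (⌊ i ≟ k ⌋ ∧ ⌊ j ≟ l ⌋) because pair-reflects i k j l

open module EdgeSets {n} = SubsetSums (_≟ₚ_ {n})

row : ∀ n → Fin n → List (Pair n)
row n i = map (i ,_) (filterᵇ (λ j → toℕ i <ᵇ toℕ j) (allFin n))

∈-pairs⁻ : ∀ {q} → q ∈ pairs n → toℕ (proj₁ q) < toℕ (proj₂ q)
∈-pairs⁻ {n} q∈ with Any.satisfied (∈-concatMap⁻ (row n) {xs = allFin n} q∈)
... | i , q∈row with ∈-map⁻ (i ,_) q∈row
... | j , j∈ , refl = <ᵇ⇒< _ _ (proj₂ (∈-filter⁻ (λ j → T? (toℕ i <ᵇ toℕ j)) {xs = allFin n} j∈))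

∈-pairs⁺ : ∀ {i j : Fin n} → toℕ i < toℕ j → (i , j) ∈ pairs n
∈-pairs⁺ {n} {i} {j} i<j = ∈-concatMap⁺ (row n) (Any.map (λ { refl → ∈-map⁺ (i ,_)
  (∈-filter⁺ (λ j → T? (toℕ i <ᵇ toℕ j)) (∈-allFin j) (<⇒<ᵇ i<j)) }) (∈-allFin i))

pairs-unique : Unique (pairs n)
pairs-unique {n} = Unique.concat⁺ (map⁺ (All.universal row-unique (allFin n)))
                           (AllPairs.map⁺ (AllPairs.map rows-disjoint (Unique.allFin⁺ n)))
  where
  row-unique : ∀ i → Unique (row n i)
  row-unique i = Unique.map⁺ ,-injectiveʳ (Unique.filter⁺ (λ j → T? (toℕ i <ᵇ toℕ j)) (Unique.allFin⁺ n))
  first∈row : ∀ {i q} → q ∈ row n i → proj₁ q ≡ i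
  first∈row q∈ with ∈-map⁻ _ q∈
  ... | _ , _ , refl = refl
  rows-disjoint : ∀ {i j} → i ≢ j → ∀ {q} → ¬ (q ∈ row n i × q ∈ row n j)
  rows-disjoint i≢j (q∈i , q∈j) = i≢j (≡-trans (sym (first∈row q∈i)) (first∈row q∈j))

module _ (G : Graph n) where

  edge-< : ∀ {i j} → toℕ i < toℕ j → edge G i j ≡ G i j
  edge-< i<j rewrite <ᵇ-true i<j = refl

  edge-> : ∀ {i j} → toℕ j < toℕ i → edge G i j ≡ G j i
  edge-> j<i rewrite <ᵇ-false (<⇒≤ j<i) | <ᵇ-true j<i = refl

  edge-refl : ∀ i → edge G i i ≡ false
  edge-refl i rewrite <ᵇ-false (≤-refl {toℕ i}) = refl

  edge-sym : ∀ i j → edge G i j ≡ edge G j i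
  edge-sym i j with <-cmp i j
  ... | tri< i<j _ _  = ≡-trans (edge-< i<j) (sym (edge-> i<j))
  ... | tri≈ _ refl _ = refl
  ... | tri> _ _ j<i  = ≡-trans (edge-> j<i) (sym (edge-< j<i))

sortPair : Fin n → Fin n → Pair n
sortPair a b = if toℕ a <ᵇ toℕ b then (a , b) else (b , a)

sortPair-< : ∀ {a b : Fin n} → toℕ a < toℕ b → sortPair a b ≡ (a , b)
sortPair-< a<b rewrite <ᵇ-true a<b = refl

sortPair-> : ∀ {a b : Fin n} → toℕ b < toℕ a → sortPair a b ≡ (b , a)
sortPair-> b<a rewrite <ᵇ-false (<⇒≤ b<a) = refl

sortPair-diag : ∀ (a : Fin n) → sortPair a a ≡ (a , a)
sortPair-diag a rewrite <ᵇ-false (≤-refl {toℕ a}) = refl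

sortPair-comm : ∀ (a b : Fin n) → sortPair a b ≡ sortPair b a
sortPair-comm a b with <-cmp a b
... | tri< a<b _ _  = ≡-trans (sortPair-< a<b) (sym (sortPair-> a<b))
... | tri≈ _ refl _ = refl
... | tri> _ _ b<a  = ≡-trans (sortPair-> b<a) (sym (sortPair-< b<a))

sortPair-∈ : ∀ {a b : Fin n} → a ≢ b → sortPair a b ∈ pairs n
sortPair-∈ {a = a} {b} a≢b with <-cmp a b
... | tri< a<b _ _   = subst (_∈ pairs _) (sym (sortPair-< a<b)) (∈-pairs⁺ a<b)
... | tri≈ _ a≡b _   = contradiction a≡b a≢b
... | tri> _ _ b<a   = subst (_∈ pairs _) (sym (sortPair-> b<a)) (∈-pairs⁺ b<a)

edgeP-sortPair : ∀ (G : Graph n) a b → edgeP G (sortPair a b) ≡ edge G a b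
edgeP-sortPair G a b with <-cmp a b
... | tri< a<b _ _  rewrite sortPair-< a<b = refl
... | tri≈ _ refl _ = cong (edgeP G) (sortPair-diag a)
... | tri> _ _ b<a  rewrite sortPair-> b<a = edge-sym G b a

relabel : (Fin n → Fin n) → Pair n → Pair n
relabel f (i , j) = sortPair (f i) (f j)

relabel-∘ : ∀ (g f : Fin n → Fin n) p → relabel g (relabel f p) ≡ relabel (g ∘ f) p
relabel-∘ g f (i , j) with toℕ (f i) <ᵇ toℕ (f j)
... | true  = refl
... | false = sortPair-comm (g (f j)) (g (f i))

relabel-id : ∀ {f : Fin n → Fin n} → (∀ i → f i ≡ i) → ∀ {p} → p ∈ pairs n → relabel f p ≡ p
relabel-id f≗id {i , j} p∈ = ≡-trans (cong₂ sortPair (f≗id i) (f≗id j)) (sortPair-< (∈-pairs⁻ p∈))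

injective⇒surjective : ∀ {f : Fin n → Fin n} → Injective _≡_ _≡_ f → ∀ y → ∃ λ x → f x ≡ y
injective⇒surjective {suc n} {f} f-inj y with any? (λ x → f x ≟ y)
... | yes hit = hit
... | no miss with pigeonhole (n<1+n n) (λ x → punchOut {i = y} {j = f x} (λ y≡fx → miss (x , sym y≡fx)))
... | i , j , i<j , same = contradiction
  (f-inj (punchOut-injective (λ y≡fi → miss (i , sym y≡fi)) (λ y≡fj → miss (j , sym y≡fj)) same)) (<⇒≢ i<j)

module _ {f : Fin n → Fin n} (f-inj : Injective _≡_ _≡_ f) where

  f⁻¹ : Fin n → Fin n
  f⁻¹ y = proj₁ (injective⇒surjective f-inj y)

  f∘f⁻¹ : ∀ y → f (f⁻¹ y) ≡ y
  f∘f⁻¹ y = proj₂ (injective⇒surjective f-inj y)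

  f⁻¹∘f : ∀ x → f⁻¹ (f x) ≡ x
  f⁻¹∘f x = f-inj (f∘f⁻¹ (f x))

  f⁻¹-injective : Injective _≡_ _≡_ f⁻¹
  f⁻¹-injective {x} {y} eq = ≡-trans (sym (f∘f⁻¹ x)) (≡-trans (cong f eq) (f∘f⁻¹ y))

  relabel-∈ : ∀ {p} → p ∈ pairs n → relabel f p ∈ pairs n
  relabel-∈ p∈ = sortPair-∈ (λ fi≡fj → <⇒≢ (∈-pairs⁻ p∈) (f-inj fi≡fj))

  relabel-injective : ∀ {p q} → p ∈ pairs n → q ∈ pairs n → relabel f p ≡ relabel f q → p ≡ q
  relabel-injective {p} {q} p∈ q∈ eq = begin
    p                          ≡⟨ sym (relabel-id f⁻¹∘f p∈) ⟩
    relabel (f⁻¹ ∘ f) p        ≡⟨ sym (relabel-∘ f⁻¹ f p) ⟩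
    relabel f⁻¹ (relabel f p)  ≡⟨ cong (relabel f⁻¹) eq ⟩
    relabel f⁻¹ (relabel f q)  ≡⟨ relabel-∘ f⁻¹ f q ⟩
    relabel (f⁻¹ ∘ f) q        ≡⟨ relabel-id f⁻¹∘f q∈ ⟩
    q                          ∎
    where open ≡-Reasoning

  relabel-↭ : map (relabel f) (pairs n) ↭ pairs n
  relabel-↭ = ∼bag⇒↭ (unique∧set⇒bag (unique-map (relabel f) relabel-injective pairs-unique) pairs-unique
                                      (mk⇔ into onto))
    where
    into : ∀ {q} → q ∈ map (relabel f) (pairs n) → q ∈ pairs n
    into q∈ with ∈-map⁻ (relabel f) q∈
    ... | p , p∈ , refl = relabel-∈ p∈
    onto : ∀ {q} → q ∈ pairs n → q ∈ map (relabel f) (pairs n)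
    onto {q} q∈ = subst (_∈ map (relabel f) (pairs n))
      (≡-trans (relabel-∘ f f⁻¹ q) (relabel-id f∘f⁻¹ q∈))
      (∈-map⁺ (relabel f) (sortPair-∈ (λ eq → <⇒≢ (∈-pairs⁻ q∈) (f⁻¹-injective eq))))

-- Graph isomorphism

allVecs-complete : ∀ {n k} (v : Vec (Fin n) k) → v ∈ allVecs n k
allVecs-complete []       = here refl
allVecs-complete {n} {suc k} (x ∷ v) =
  ∈-concatMap⁺ (λ y → map (y ∷_) (allVecs n k))
               (Any.map (λ { refl → ∈-map⁺ (x ∷_) (allVecs-complete v) }) (∈-allFin x))

record IsIso (f : Fin n → Fin n) (G K : Graph n) : Set where
  constructor _,_
  field
    injective : Injective _≡_ _≡_ f
    preserves : ∀ i j → edge G i j ≡ edge K (f i) (f j)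

isIso-from-< : ∀ {f : Fin n → Fin n} {G K} → Injective _≡_ _≡_ f →
               (∀ {i j} → toℕ i < toℕ j → edge G i j ≡ edge K (f i) (f j)) → IsIso f G K
isIso-from-< {f = f} {G} {K} f-inj pres = f-inj , preserves
  where
  preserves : ∀ i j → edge G i j ≡ edge K (f i) (f j)
  preserves i j with <-cmp i j
  ... | tri< i<j _ _  = pres i<j
  ... | tri≈ _ refl _ = ≡-trans (edge-refl G i) (sym (edge-refl K (f i)))
  ... | tri> _ _ j<i  = ≡-trans (edge-sym G i j) (≡-trans (pres j<i) (edge-sym K (f j) (f i)))

isIso-∘ : ∀ {f g : Fin n → Fin n} {G H K} → IsIso f G H → IsIso g H K → IsIso (g ∘ f) G K
isIso-∘ {f = f} (f-inj , f-pres) (g-inj , g-pres) =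
  f-inj ∘ g-inj , λ i j → ≡-trans (f-pres i j) (g-pres (f i) (f j))

isIso-sym : ∀ {f : Fin n → Fin n} {G H} → (iso : IsIso f G H) → IsIso (f⁻¹ (IsIso.injective iso)) H G
isIso-sym {f = f} {G} {H} (f-inj , f-pres) = f⁻¹-injective f-inj , λ i j → sym (begin
  edge G (f⁻¹ f-inj i) (f⁻¹ f-inj j)          ≡⟨ f-pres _ _ ⟩
  edge H (f (f⁻¹ f-inj i)) (f (f⁻¹ f-inj j))  ≡⟨ cong₂ (edge H) (f∘f⁻¹ f-inj i) (f∘f⁻¹ f-inj j) ⟩
  edge H i j                                  ∎)
  where open ≡-Reasoning

isoB-complete : ∀ {f : Fin n → Fin n} {G K} → IsIso f G K → isoB G K ≡ true
isoB-complete {n} {f} {G} {K} (f-inj , f-pres) =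
  any-intro {xs = allVecs n n} _ (allVecs-complete σ) (cong₂ _∧_ injective preserving)
  where
  σ : Vec (Fin n) n
  σ = tabulate f
  injective : injB σ ≡ true
  injective = all-intro {xs = pairs n} λ { {i , j} ij∈ → distinct (∈-pairs⁻ ij∈) }
    where
    distinct : ∀ {i j} → toℕ i < toℕ j → not ⌊ lookup σ i ≟ lookup σ j ⌋ ≡ true
    distinct {i} {j} i<j rewrite lookup∘tabulate f i | lookup∘tabulate f j with f i ≟ f j
    ... | yes fi≡fj = contradiction (f-inj fi≡fj) (<⇒≢ i<j)
    ... | no _      = refl
  preserving : preservesB σ G K ≡ true
  preserving = all-intro {xs = pairs n} λ { {i , j} _ → agree i j }
    where
    agree : ∀ i j → (if edge G i j then edge K (lookup σ i) (lookup σ j)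
                                    else not (edge K (lookup σ i) (lookup σ j))) ≡ true
    agree i j rewrite lookup∘tabulate f i | lookup∘tabulate f j | f-pres i j with edge K (f i) (f j)
    ... | true  = refl
    ... | false = refl

isoB-sound : ∀ {G K : Graph n} → isoB G K ≡ true → ∃ λ f → IsIso f G K
isoB-sound {n} {G} {K} iso≡true with any-elim (allVecs n n) (λ σ → injB σ ∧ preservesB σ G K) iso≡true
... | σ , _ , ok =
  lookup σ , isIso-from-< {G = G} {K} injective λ i<j → agree (all-elim (proj₂ oks) (∈-pairs⁺ i<j))
  where
  ∧-true : ∀ a {b} → a ∧ b ≡ true → a ≡ true × b ≡ true
  ∧-true true b≡true = refl , b≡true
  oks : injB σ ≡ true × preservesB σ G K ≡ true
  oks = ∧-true (injB σ) ok
  distinct : ∀ {i j} → toℕ i < toℕ j → lookup σ i ≢ lookup σ j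
  distinct {i} {j} i<j σi≡σj with lookup σ i ≟ lookup σ j | all-elim (proj₁ oks) (∈-pairs⁺ {i = i} {j} i<j)
  ... | yes _    | ()
  ... | no σi≢σj | _ = σi≢σj σi≡σj
  injective : Injective _≡_ _≡_ (lookup σ)
  injective {i} {j} σi≡σj with <-cmp i j
  ... | tri< i<j _ _ = contradiction σi≡σj (distinct i<j)
  ... | tri≈ _ i≡j _ = i≡j
  ... | tri> _ _ j<i = contradiction (sym σi≡σj) (distinct j<i)
  agree : ∀ {a b : Bool} → (if a then b else not b) ≡ true → a ≡ b
  agree {true}  {true}  _ = refl
  agree {false} {false} _ = refl

isoB-resp : ∀ {f : Fin n → Fin n} {G H} → IsIso f G H → ∀ K → isoB G K ≡ isoB H K
isoB-resp {G = G} {H} G≅H K = ⇔⇒≡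
  (λ G≅K → isoB-complete (isIso-∘ (isIso-sym G≅H) (proj₂ (isoB-sound {G = G} {K} G≅K))))
  (λ H≅K → isoB-complete (isIso-∘ G≅H (proj₂ (isoB-sound {G = H} {K} H≅K))))
  where
  ⇔⇒≡ : ∀ {a b} → (a ≡ true → b ≡ true) → (b ≡ true → a ≡ true) → a ≡ b
  ⇔⇒≡ {true}  {b}     a⇒b _   = sym (a⇒b refl)
  ⇔⇒≡ {false} {true}  _   b⇒a = b⇒a refl
  ⇔⇒≡ {false} {false} _   _   = refl

-- Labelled copies and the entries of Δⱼ

-- Only the ordered pairs, i.e. the members of pairs n, carry information.
EdgeSet : ℕ → Set
EdgeSet n = Pair n → Bool

graph : EdgeSet n → Graph n
graph s i j = s (i , j)

∣_∣ : EdgeSet n → ℕ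
∣_∣ {n} s = countB s (pairs n)

_⊆ᵉ_ : EdgeSet n → EdgeSet n → Bool
_⊆ᵉ_ {n} s t = s ⊆⟨ pairs n ⟩ t

_≅ᵇ_ : EdgeSet n → Graph n → Bool
s ≅ᵇ K = isoB (graph s) K

edgeP-graph : ∀ (s : EdgeSet n) {q} → q ∈ pairs n → edgeP (graph s) q ≡ s q
edgeP-graph s q∈ = edge-< (graph s) (∈-pairs⁻ q∈)

≅ᵇ-local : ∀ (K : Graph n) → Local (pairs n) (λ s → s ≅ᵇ K)
≅ᵇ-local K {s} {t} s≐t = isoB-resp (isIso-from-< (λ eq → eq) same) K
  where
  same : ∀ {i j} → toℕ i < toℕ j → edge (graph s) i j ≡ edge (graph t) i j
  same i<j = ≡-trans (edge-< (graph s) i<j) (≡-trans (s≐t (∈-pairs⁺ i<j)) (sym (edge-< (graph t) i<j)))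

edgeP-≅ᵇ : ∀ (G : Graph n) → edgeP G ≅ᵇ G ≡ true
edgeP-≅ᵇ G = isoB-complete (isIso-from-< (λ eq → eq) (edge-< (graph (edgeP G))))

≅ᵇ⇒relabelling : ∀ {e : EdgeSet n} {G} → e ≅ᵇ G ≡ true →
                 ∃ λ f → Injective _≡_ _≡_ f × e ≐⟨ pairs n ⟩ (edgeP G ∘ relabel f)
≅ᵇ⇒relabelling {e = e} {G} e≅G with isoB-sound {G = graph e} {G} e≅G
... | f , (f-inj , pres) = f , f-inj , λ {q} q∈ → begin
  e q                                   ≡⟨ sym (edgeP-graph e q∈) ⟩
  edge (graph e) (proj₁ q) (proj₂ q)    ≡⟨ pres (proj₁ q) (proj₂ q) ⟩
  edge G (f (proj₁ q)) (f (proj₂ q))    ≡⟨ sym (edgeP-sortPair G (f (proj₁ q)) (f (proj₂ q))) ⟩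
  edgeP G (relabel f q)                 ∎
  where open ≡-Reasoning

copiesAbove : ℕ → Graph n → EdgeSet n → ℕ
copiesAbove {n} m K s = ∑[ e ⊆ pairs n ] [ s ⊆ᵉ e ] * ([ ∣ e ∣ ≡ᵇ m ] * [ e ≅ᵇ K ])

copies : ℕ → Graph n → ℕ
copies {n} m K = ∑[ e ⊆ pairs n ] [ ∣ e ∣ ≡ᵇ m ] * [ e ≅ᵇ K ]

-- Ways to keep s ⊆ g with |s| = m − j and complete it to a labelled copy of K with m edges;
-- for g = edgeP L this is the entry (Δⱼ)_{[K],[L]} (Δentry≡exchanges).
exchanges : ℕ → ℕ → Graph n → EdgeSet n → ℕ
exchanges {n} j m K g = ∑[ s ⊆ pairs n ] [ s ⊆ᵉ g ] * ([ ∣ s ∣ + j ≡ᵇ m ] * copiesAbove m K s)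

overlaps : ℕ → ℕ → Graph n → Graph n → ℕ
overlaps {n} j m X Y = ∑[ s ⊆ pairs n ] [ ∣ s ∣ + j ≡ᵇ m ] * (copiesAbove m X s * copiesAbove m Y s)

copiesAbove-local : ∀ m (K : Graph n) → Local (pairs n) (copiesAbove m K)
copiesAbove-local {n} m K s≐t =
  ∑-cong (pairs n) (λ e → cong (λ b → [ b ] * ([ ∣ e ∣ ≡ᵇ m ] * [ e ≅ᵇ K ])) (⊆-localˡ e s≐t))

exchanges-local : ∀ j m (K : Graph n) → Local (pairs n) (exchanges j m K)
exchanges-local {n} j m K g≐g′ =
  ∑-cong (pairs n) (λ s → cong (λ b → [ b ] * ([ ∣ s ∣ + j ≡ᵇ m ] * copiesAbove m K s))
                              (⊆-localʳ s g≐g′))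

module _ {f : Fin n → Fin n} (f-inj : Injective _≡_ _≡_ f) where

  ∑-relabel : ∀ {h : EdgeSet n → ℕ} → Local (pairs n) h →
              ∑[ s ⊆ pairs n ] h (s ∘ relabel f) ≡ ∑ (pairs n) h
  ∑-relabel {h} lh =
    ≡-trans (∑-↭ (λ s≐t → lh (λ p∈ → s≐t (relabel-∈ f-inj p∈))) (↭-sym (relabel-↭ f-inj)))
            (∑-map (relabel f) (pairs n) (relabel-injective f-inj) lh)

  ∣∣-relabel : ∀ s → ∣ s ∘ relabel f ∣ ≡ ∣ s ∣
  ∣∣-relabel s = ≡-trans (sym (countB-map s (relabel f) (pairs n))) (countB-↭ s (relabel-↭ f-inj))

  ⊆ᵉ-relabel : ∀ s t → (s ∘ relabel f) ⊆ᵉ (t ∘ relabel f) ≡ s ⊆ᵉ t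
  ⊆ᵉ-relabel s t = ≡-trans (cong and (map-∘ (pairs n))) (all-↭ (λ p → not (s p) ∨ t p) (relabel-↭ f-inj))

  ≅ᵇ-relabel : ∀ s K → (s ∘ relabel f) ≅ᵇ K ≡ s ≅ᵇ K
  ≅ᵇ-relabel s K = isoB-resp (isIso-from-< f-inj same) K
    where
    same : ∀ {i j} → toℕ i < toℕ j → edge (graph (s ∘ relabel f)) i j ≡ edge (graph s) (f i) (f j)
    same {i} {j} i<j = begin
      edge (graph (s ∘ relabel f)) i j   ≡⟨ edge-< (graph (s ∘ relabel f)) i<j ⟩
      s (relabel f (i , j))              ≡⟨ sym (edgeP-graph s (relabel-∈ f-inj (∈-pairs⁺ i<j))) ⟩
      edgeP (graph s) (relabel f (i , j)) ≡⟨ edgeP-sortPair (graph s) (f i) (f j) ⟩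
      edge (graph s) (f i) (f j)         ∎
      where open ≡-Reasoning

  copiesAbove-relabel : ∀ m K s → copiesAbove m K (s ∘ relabel f) ≡ copiesAbove m K s
  copiesAbove-relabel m K s = ≡-trans (sym (∑-relabel local)) (∑-cong (pairs n) relabelled)
    where
    local : Local (pairs n) (λ e → [ (s ∘ relabel f) ⊆ᵉ e ] * ([ ∣ e ∣ ≡ᵇ m ] * [ e ≅ᵇ K ]))
    local e≐e′ = cong₂ (λ a b → [ a ] * b) (⊆-localʳ _ e≐e′)
                       (cong₂ (λ c d → [ c ≡ᵇ m ] * [ d ]) (countB-local e≐e′) (≅ᵇ-local K e≐e′))
    relabelled : ∀ e → [ (s ∘ relabel f) ⊆ᵉ (e ∘ relabel f) ]
                         * ([ ∣ e ∘ relabel f ∣ ≡ᵇ m ] * [ (e ∘ relabel f) ≅ᵇ K ])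
                     ≡ [ s ⊆ᵉ e ] * ([ ∣ e ∣ ≡ᵇ m ] * [ e ≅ᵇ K ])
    relabelled e = cong₂ (λ a b → [ a ] * b) (⊆ᵉ-relabel s e)
                         (cong₂ (λ c d → [ c ≡ᵇ m ] * [ d ]) (∣∣-relabel e) (≅ᵇ-relabel e K))

  exchanges-relabel : ∀ j m K g → exchanges j m K (g ∘ relabel f) ≡ exchanges j m K g
  exchanges-relabel j m K g = ≡-trans (sym (∑-relabel local)) (∑-cong (pairs n) relabelled)
    where
    local : Local (pairs n) (λ s → [ s ⊆ᵉ (g ∘ relabel f) ] * ([ ∣ s ∣ + j ≡ᵇ m ] * copiesAbove m K s))
    local s≐t = cong₂ (λ a b → [ a ] * b) (⊆-localˡ _ s≐t)
                      (cong₂ (λ c d → [ c + j ≡ᵇ m ] * d) (countB-local s≐t) (copiesAbove-local m K s≐t))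
    relabelled : ∀ s → [ (s ∘ relabel f) ⊆ᵉ (g ∘ relabel f) ]
                         * ([ ∣ s ∘ relabel f ∣ + j ≡ᵇ m ] * copiesAbove m K (s ∘ relabel f))
                     ≡ [ s ⊆ᵉ g ] * ([ ∣ s ∣ + j ≡ᵇ m ] * copiesAbove m K s)
    relabelled s = cong₂ (λ a b → [ a ] * b) (⊆ᵉ-relabel s g)
                         (cong₂ (λ c d → [ c + j ≡ᵇ m ] * d) (∣∣-relabel s) (copiesAbove-relabel m K s))

Δentry≡exchanges : ∀ j (K L : Graph n) → Δentry j K L ≡ exchanges j (numEdges L) K (edgeP L)
Δentry≡exchanges {n} j K L = begin
  Δentry j K L
    ≡⟨ countB-concatMap exchanged additions (choose j (edges L)) ⟩
  sum (map (λ A → countB exchanged (additions A)) (choose j (edges L)))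
    ≡⟨ cong sum (map-cong (λ A → ≡-trans (countB-map exchanged (A ,_) (choose j (nonEdges (removeE L A))))
                                          (countB-as-sum (exchanged ∘ (A ,_)) (choose j (nonEdges (removeE L A)))))
                          (choose j (edges L))) ⟩
  sum (map (λ A → sum (map (λ B → [ (edgeP (removeE L A) ∪ ⟦ B ⟧) ≅ᵇ K ])
                          (choose j (nonEdges (removeE L A)))))
           (choose j (edges L)))
    ≡⟨ cong sum (map-cong (λ A → ≡-trans (extensions-∑ pairs-unique (edgeP (removeE L A)) j
                                                         (λ s≐t → cong [_] (≅ᵇ-local K s≐t)))
                                          (local-h (remaining A)))
                          (choose j (edges L))) ⟩
  sum (map (λ A → h (edgeP L ∖ ⟦ A ⟧)) (choose j (edges L)))
    ≡⟨ removals-∑ pairs-unique (edgeP L) j local-h ⟩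
  ∑[ s ⊆ pairs n ] [ s ⊆ᵉ edgeP L ] * ([ ∣ s ∣ + j ≡ᵇ numEdges L ] * h s)
    ≡⟨ ∑-cong (pairs n) (λ s → cong ([ s ⊆ᵉ edgeP L ] *_)
                                    (≡ᵇ-guard (∣ s ∣ + j) (numEdges L) (λ m → copiesAbove m K s))) ⟩
  exchanges j (numEdges L) K (edgeP L) ∎
  where
  open ≡-Reasoning
  exchanged : List (Pair n) × List (Pair n) → Bool
  exchanged (A , B) = isoB (addE (removeE L A) B) K
  additions : List (Pair n) → List (List (Pair n) × List (Pair n))
  additions A = map (A ,_) (choose j (nonEdges (removeE L A)))
  h : EdgeSet n → ℕ
  h s = copiesAbove (∣ s ∣ + j) K s
  local-h : Local (pairs n) h
  local-h {s} s≐t = ≡-trans (cong (λ c → copiesAbove (c + j) K s) (countB-local s≐t)) (copiesAbove-local _ K s≐t)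
  remaining : ∀ A → edgeP (removeE L A) ≐⟨ pairs n ⟩ (edgeP L ∖ ⟦ A ⟧)
  remaining A q∈ = edge-< (removeE L A) (∈-pairs⁻ q∈)

exchanges-copy : ∀ {j m} {G : Graph n} K {e} → numEdges G ≡ m → e ≅ᵇ G ≡ true →
                 exchanges j m K e ≡ Δentry j K G
exchanges-copy {j = j} {G = G} K {e} refl e≅G with ≅ᵇ⇒relabelling {e = e} {G} e≅G
... | f , f-inj , e≐G∘f = begin
  exchanges j (numEdges G) K e                      ≡⟨ exchanges-local j (numEdges G) K e≐G∘f ⟩
  exchanges j (numEdges G) K (edgeP G ∘ relabel f)  ≡⟨ exchanges-relabel f-inj j _ K (edgeP G) ⟩
  exchanges j (numEdges G) K (edgeP G)              ≡⟨ sym (Δentry≡exchanges j K G) ⟩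
  Δentry j K G                                      ∎
  where open ≡-Reasoning

overlaps≡∑exchanges : ∀ j m (X Y : Graph n) →
  overlaps j m X Y ≡ ∑[ e ⊆ pairs n ] ([ ∣ e ∣ ≡ᵇ m ] * [ e ≅ᵇ X ]) * exchanges j m Y e
overlaps≡∑exchanges {n} j m X Y = begin
  ∑[ s ⊆ U ] [ ∣ s ∣ + j ≡ᵇ m ] * (copiesAbove m X s * copiesAbove m Y s)
    ≡⟨ ∑-cong U (λ s → ≡-trans (rearrange₁ [ ∣ s ∣ + j ≡ᵇ m ] (copiesAbove m X s) (copiesAbove m Y s))
                               (sym (*-distribˡ-∑ U (weight s) (λ e → [ s ⊆ᵉ e ] * copy e)))) ⟩
  ∑[ s ⊆ U ] ∑[ e ⊆ U ] weight s * ([ s ⊆ᵉ e ] * copy e)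
    ≡⟨ ∑-comm U U (λ s e → weight s * ([ s ⊆ᵉ e ] * copy e)) ⟩
  ∑[ e ⊆ U ] ∑[ s ⊆ U ] weight s * ([ s ⊆ᵉ e ] * copy e)
    ≡⟨ ∑-cong U (λ e → ≡-trans (∑-cong U (λ s → rearrange₂ [ ∣ s ∣ + j ≡ᵇ m ] (copiesAbove m Y s)
                                                           [ s ⊆ᵉ e ] (copy e)))
                               (*-distribˡ-∑ U (copy e) (λ s → [ s ⊆ᵉ e ] * weight s))) ⟩
  ∑[ e ⊆ U ] copy e * exchanges j m Y e ∎
  where
  open ≡-Reasoning
  U : List (Pair n)
  U = pairs n
  copy : EdgeSet n → ℕ
  copy e = [ ∣ e ∣ ≡ᵇ m ] * [ e ≅ᵇ X ]
  weight : EdgeSet n → ℕ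
  weight s = [ ∣ s ∣ + j ≡ᵇ m ] * copiesAbove m Y s
  rearrange₁ : ∀ c x y → c * (x * y) ≡ (c * y) * x
  rearrange₁ = solve-∀
  rearrange₂ : ∀ c y i k → (c * y) * (i * k) ≡ k * (i * (c * y))
  rearrange₂ = solve-∀

overlaps≡copies*Δentry : ∀ j {m} {G : Graph n} K → numEdges G ≡ m →
                         overlaps j m G K ≡ copies m G * Δentry j K G
overlaps≡copies*Δentry {n} j {m} {G} K eG = begin
  overlaps j m G K
    ≡⟨ overlaps≡∑exchanges j m G K ⟩
  ∑[ e ⊆ pairs n ] ([ ∣ e ∣ ≡ᵇ m ] * [ e ≅ᵇ G ]) * exchanges j m K e
    ≡⟨ ∑-cong (pairs n) at-copy ⟩
  ∑[ e ⊆ pairs n ] ([ ∣ e ∣ ≡ᵇ m ] * [ e ≅ᵇ G ]) * Δentry j K G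
    ≡⟨ *-distribʳ-∑ (pairs n) (Δentry j K G) (λ e → [ ∣ e ∣ ≡ᵇ m ] * [ e ≅ᵇ G ]) ⟩
  copies m G * Δentry j K G ∎
  where
  open ≡-Reasoning
  at-copy : ∀ e → ([ ∣ e ∣ ≡ᵇ m ] * [ e ≅ᵇ G ]) * exchanges j m K e
                ≡ ([ ∣ e ∣ ≡ᵇ m ] * [ e ≅ᵇ G ]) * Δentry j K G
  at-copy e = ≡-trans (*-assoc [ ∣ e ∣ ≡ᵇ m ] _ _) (≡-trans
    (cong ([ ∣ e ∣ ≡ᵇ m ] *_) ([]*-cong (e ≅ᵇ G) (exchanges-copy K eG)))
    (sym (*-assoc [ ∣ e ∣ ≡ᵇ m ] _ _)))

copies-positive : ∀ {m} {G : Graph n} → numEdges G ≡ m → 0 < copies m G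
copies-positive {n} {G = G} refl = ≤-trans (≤-reflexive (sym at-G)) (term≤∑ (pairs n) local (edgeP G))
  where
  at-G : [ ∣ edgeP G ∣ ≡ᵇ numEdges G ] * [ edgeP G ≅ᵇ G ] ≡ 1
  at-G rewrite ≡ᵇ-refl (numEdges G) | edgeP-≅ᵇ G = refl
  local : Local (pairs n) (λ e → [ ∣ e ∣ ≡ᵇ numEdges G ] * [ e ≅ᵇ G ])
  local e≐e′ = cong₂ (λ c d → [ c ≡ᵇ numEdges G ] * [ d ]) (countB-local e≐e′) (≅ᵇ-local G e≐e′)

-- For a copy e ⊇ r with m edges, exactly C(i, i ∸ k) sets of size m − k lie between r and e.
copiesAbove-lift : ∀ {m i} k (X : Graph n) r → ∣ r ∣ + i ≡ m → k ≤ i →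
  ∑[ s ⊆ pairs n ] [ ∣ s ∣ + k ≡ᵇ m ] * ([ r ⊆ᵉ s ] * copiesAbove m X s)
    ≡ (i C (i ∸ k)) * copiesAbove m X r
copiesAbove-lift {n} {m} {i} k X r |r|+i≡m k≤i = begin
  ∑[ s ⊆ U ] [ ∣ s ∣ + k ≡ᵇ m ] * ([ r ⊆ᵉ s ] * copiesAbove m X s)
    ≡⟨ ∑-cong U (λ s → ≡-trans (sym (*-assoc [ ∣ s ∣ + k ≡ᵇ m ] _ _))
                               (sym (*-distribˡ-∑ U ([ ∣ s ∣ + k ≡ᵇ m ] * [ r ⊆ᵉ s ])
                                                    (λ e → [ s ⊆ᵉ e ] * copy e)))) ⟩
  ∑[ s ⊆ U ] ∑[ e ⊆ U ] ([ ∣ s ∣ + k ≡ᵇ m ] * [ r ⊆ᵉ s ]) * ([ s ⊆ᵉ e ] * copy e)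
    ≡⟨ ∑-comm U U (λ s e → ([ ∣ s ∣ + k ≡ᵇ m ] * [ r ⊆ᵉ s ]) * ([ s ⊆ᵉ e ] * copy e)) ⟩
  ∑[ e ⊆ U ] ∑[ s ⊆ U ] ([ ∣ s ∣ + k ≡ᵇ m ] * [ r ⊆ᵉ s ]) * ([ s ⊆ᵉ e ] * copy e)
    ≡⟨ ∑-cong U (λ e → ≡-trans (∑-cong U (regroup e)) (*-distribˡ-∑ U (copy e) (between e))) ⟩
  ∑[ e ⊆ U ] copy e * (∑[ s ⊆ U ] between e s)
    ≡⟨ ∑-cong U count-between ⟩
  ∑[ e ⊆ U ] copy e * ([ r ⊆ᵉ e ] * (i C (i ∸ k)))
    ≡⟨ ∑-cong U (λ e → rearrange (copy e) [ r ⊆ᵉ e ] ((i C (i ∸ k)))) ⟩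
  ∑[ e ⊆ U ] (i C (i ∸ k)) * ([ r ⊆ᵉ e ] * copy e)
    ≡⟨ *-distribˡ-∑ U ((i C (i ∸ k))) (λ e → [ r ⊆ᵉ e ] * copy e) ⟩
  (i C (i ∸ k)) * copiesAbove m X r ∎
  where
  open ≡-Reasoning
  U : List (Pair n)
  U = pairs n
  copy : EdgeSet n → ℕ
  copy e = [ ∣ e ∣ ≡ᵇ m ] * [ e ≅ᵇ X ]
  between : EdgeSet n → EdgeSet n → ℕ
  between e s = [ r ⊆ᵉ s ∧ s ⊆ᵉ e ] * [ ∣ s ∣ ≡ᵇ ∣ r ∣ + (i ∸ k) ]
  level : ∀ s → (∣ s ∣ + k ≡ᵇ m) ≡ (∣ s ∣ ≡ᵇ ∣ r ∣ + (i ∸ k))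
  level s = begin
    (∣ s ∣ + k ≡ᵇ m)
      ≡⟨ cong (∣ s ∣ + k ≡ᵇ_) (sym (≡-trans (+-assoc ∣ r ∣ (i ∸ k) k)
                                            (≡-trans (cong (∣ r ∣ +_) (m∸n+n≡m k≤i)) |r|+i≡m))) ⟩
    (∣ s ∣ + k ≡ᵇ ∣ r ∣ + (i ∸ k) + k)
      ≡⟨ cong₂ _≡ᵇ_ (+-comm ∣ s ∣ k) (+-comm (∣ r ∣ + (i ∸ k)) k) ⟩
    (k + ∣ s ∣ ≡ᵇ k + (∣ r ∣ + (i ∸ k)))
      ≡⟨ ≡ᵇ-+ˡ k ∣ s ∣ (∣ r ∣ + (i ∸ k)) ⟩
    (∣ s ∣ ≡ᵇ ∣ r ∣ + (i ∸ k)) ∎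
  regroup : ∀ e s → ([ ∣ s ∣ + k ≡ᵇ m ] * [ r ⊆ᵉ s ]) * ([ s ⊆ᵉ e ] * copy e) ≡ copy e * between e s
  regroup e s rewrite level s | [∧] (r ⊆ᵉ s) (s ⊆ᵉ e) =
    reorder [ ∣ s ∣ ≡ᵇ ∣ r ∣ + (i ∸ k) ] [ r ⊆ᵉ s ] [ s ⊆ᵉ e ] (copy e)
    where
    reorder : ∀ c a b y → (c * a) * (b * y) ≡ y * ((a * b) * c)
    reorder = solve-∀
  count-between : ∀ e → copy e * (∑[ s ⊆ U ] between e s) ≡ copy e * ([ r ⊆ᵉ e ] * (i C (i ∸ k)))
  count-between e = ≡-trans (*-assoc [ ∣ e ∣ ≡ᵇ m ] _ _) (≡-trans
    ([]*-cong (∣ e ∣ ≡ᵇ m) λ |e|≡ᵇm →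
      cong ([ e ≅ᵇ X ] *_)
           (∑-interval (pairs-unique {n}) {r} {e} i (i ∸ k) (≡-trans |r|+i≡m (sym (≡ᵇ-≡ |e|≡ᵇm)))))
    (sym (*-assoc [ ∣ e ∣ ≡ᵇ m ] _ _)))
  rearrange : ∀ y a c → y * (a * c) ≡ c * (a * y)
  rearrange = solve-∀

overlaps-comm : ∀ j m (X Y : Graph n) → overlaps j m X Y ≡ overlaps j m Y X
overlaps-comm {n} j m X Y =
  ∑-cong (pairs n) (λ s → cong ([ ∣ s ∣ + j ≡ᵇ m ] *_) (*-comm (copiesAbove m X s) (copiesAbove m Y s)))

overlaps-scaled : ∀ j m c d (X Y : Graph n) →
  ∑[ s ⊆ pairs n ] [ ∣ s ∣ + j ≡ᵇ m ] * ((c * copiesAbove m X s) * (d * copiesAbove m Y s))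
    ≡ (c * d) * overlaps j m X Y
overlaps-scaled {n} j m c d X Y =
  ≡-trans (∑-cong (pairs n) (λ s → regroup [ ∣ s ∣ + j ≡ᵇ m ] c d (copiesAbove m X s) (copiesAbove m Y s)))
          (*-distribˡ-∑ (pairs n) (c * d) _)
  where
  regroup : ∀ l c d p q → l * ((c * p) * (d * q)) ≡ (c * d) * (l * (p * q))
  regroup = solve-∀

*-copiesAbove-lift : ∀ {m i} k c (X : Graph n) r → ∣ r ∣ + i ≡ m → k ≤ i →
  ∑[ s ⊆ pairs n ] [ ∣ s ∣ + k ≡ᵇ m ] * ([ r ⊆ᵉ s ] * (c * copiesAbove m X s))
    ≡ (i C (i ∸ k)) * (c * copiesAbove m X r)
*-copiesAbove-lift {n} {m} {i} k c X r |r|+i≡m k≤i = begin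
  ∑[ s ⊆ pairs n ] [ ∣ s ∣ + k ≡ᵇ m ] * ([ r ⊆ᵉ s ] * (c * copiesAbove m X s))
    ≡⟨ ∑-cong (pairs n) (λ s → regroup c [ ∣ s ∣ + k ≡ᵇ m ] [ r ⊆ᵉ s ] (copiesAbove m X s)) ⟩
  ∑[ s ⊆ pairs n ] c * ([ ∣ s ∣ + k ≡ᵇ m ] * ([ r ⊆ᵉ s ] * copiesAbove m X s))
    ≡⟨ *-distribˡ-∑ (pairs n) c _ ⟩
  c * (∑[ s ⊆ pairs n ] [ ∣ s ∣ + k ≡ᵇ m ] * ([ r ⊆ᵉ s ] * copiesAbove m X s))
    ≡⟨ cong (c *_) (copiesAbove-lift k X r |r|+i≡m k≤i) ⟩
  c * ((i C (i ∸ k)) * copiesAbove m X r)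
    ≡⟨ exchange c (i C (i ∸ k)) (copiesAbove m X r) ⟩
  (i C (i ∸ k)) * (c * copiesAbove m X r) ∎
  where
  open ≡-Reasoning
  regroup : ∀ c l t p → l * (t * (c * p)) ≡ c * (l * (t * p))
  regroup = solve-∀
  exchange : ∀ c w p → c * (w * p) ≡ w * (c * p)
  exchange = solve-∀

-- Proportionality of copy counts

module _ {n m} {G H : Graph n} (eG : numEdges G ≡ m) (eH : numEdges H ≡ m) where

  private
    a b : ℕ
    a = copies m G
    b = copies m H

    x y : EdgeSet n → ℕ
    x s = b * copiesAbove m G s
    y s = a * copiesAbove m H s

    local-x : Local (pairs n) x
    local-x s≐t = cong (b *_) (copiesAbove-local m G s≐t)

    local-y : Local (pairs n) y
    local-y s≐t = cong (a *_) (copiesAbove-local m H s≐t)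

  -- P_G / a_G and P_H / a_H agree on all (m − j)-sets.
  Proportional : ℕ → Set
  Proportional j = ∀ r → ∣ r ∣ + j ≡ m → x r ≡ y r

  gram-identity : ∀ k → VanishesOn m (ΔX k G H) →
    ∑[ s ⊆ pairs n ] [ ∣ s ∣ + k ≡ᵇ m ] * (2 * (x s * y s))
      ≡ ∑[ s ⊆ pairs n ] [ ∣ s ∣ + k ≡ᵇ m ] * (x s * x s + y s * y s)
  gram-identity k Δk≡0 = begin
    ∑[ s ⊆ pairs n ] [ level s ] * (2 * (x s * y s))
      ≡⟨ ∑-cong (pairs n) (λ s → double [ level s ] (x s * y s)) ⟩
    ∑[ s ⊆ pairs n ] ([ level s ] * (x s * y s) + [ level s ] * (x s * y s))
      ≡⟨ ∑-distrib-+ (pairs n) _ _ ⟩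
    (∑[ s ⊆ pairs n ] [ level s ] * (x s * y s)) + (∑[ s ⊆ pairs n ] [ level s ] * (x s * y s))
      ≡⟨ cong₂ _+_ (overlaps-scaled k m b a G H)
                   (≡-trans (overlaps-scaled k m b a G H) (cong ((b * a) *_) (overlaps-comm k m G H))) ⟩
    (b * a) * overlaps k m G H + (b * a) * overlaps k m H G
      ≡⟨ cong₂ (λ o o′ → (b * a) * o + (b * a) * o′)
               (overlaps≡copies*Δentry k H eG) (overlaps≡copies*Δentry k G eH) ⟩
    (b * a) * (a * Δentry k H G) + (b * a) * (b * Δentry k G H)
      ≡⟨ cong₂ (λ d d′ → (b * a) * (a * d) + (b * a) * (b * d′)) ΔHG≡ΔHH (sym ΔGG≡ΔGH) ⟩
    (b * a) * (a * Δentry k H H) + (b * a) * (b * Δentry k G G)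
      ≡⟨ regroup a b (Δentry k H H) (Δentry k G G) ⟩
    (b * b) * (a * Δentry k G G) + (a * a) * (b * Δentry k H H)
      ≡⟨ cong₂ (λ o o′ → (b * b) * o + (a * a) * o′)
               (sym (overlaps≡copies*Δentry k G eG)) (sym (overlaps≡copies*Δentry k H eH)) ⟩
    (b * b) * overlaps k m G G + (a * a) * overlaps k m H H
      ≡⟨ sym (cong₂ _+_ (overlaps-scaled k m b b G G) (overlaps-scaled k m a a H H)) ⟩
    (∑[ s ⊆ pairs n ] [ level s ] * (x s * x s)) + (∑[ s ⊆ pairs n ] [ level s ] * (y s * y s))
      ≡⟨ sym (∑-distrib-+ (pairs n) _ _) ⟩
    ∑[ s ⊆ pairs n ] ([ level s ] * (x s * x s) + [ level s ] * (y s * y s))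
      ≡⟨ ∑-cong (pairs n) (λ s → sym (*-distribˡ-+ [ level s ] (x s * x s) (y s * y s))) ⟩
    ∑[ s ⊆ pairs n ] [ level s ] * (x s * x s + y s * y s) ∎
    where
    open ≡-Reasoning
    level : EdgeSet n → Bool
    level s = ∣ s ∣ + k ≡ᵇ m
    ΔGG≡ΔGH : Δentry k G G ≡ Δentry k G H
    ΔGG≡ΔGH = ℤ.+-injective (ℤ.i-j≡0⇒i≡j _ _ (Δk≡0 G eG))
    ΔHG≡ΔHH : Δentry k H G ≡ Δentry k H H
    ΔHG≡ΔHH = ℤ.+-injective (ℤ.i-j≡0⇒i≡j _ _ (Δk≡0 H eH))
    double : ∀ l p → l * (2 * p) ≡ l * p + l * p
    double = solve-∀
    regroup : ∀ a b p q → (b * a) * (a * p) + (b * a) * (b * q) ≡ (b * b) * (a * q) + (a * a) * (b * p)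
    regroup = solve-∀

  -- AM–GM is tight in every term of the Gram identity.
  vanishing⇒proportional : ∀ k → VanishesOn m (ΔX k G H) → Proportional k
  vanishing⇒proportional k Δk≡0 r |r|+k≡m =
    am-gm-equality ([]*-injective (≡⇒≡ᵇ-true |r|+k≡m)
      (∑-tight (pairs n) local-products local-squares bound (gram-identity k Δk≡0) r))
    where
    level : EdgeSet n → Bool
    level s = ∣ s ∣ + k ≡ᵇ m
    bound : ∀ s → [ level s ] * (2 * (x s * y s)) ≤ [ level s ] * (x s * x s + y s * y s)
    bound s = *-monoʳ-≤ [ level s ] (am-gm (x s) (y s))
    local-level : Local (pairs n) level
    local-level s≐t = cong (λ c → c + k ≡ᵇ m) (countB-local s≐t)
    local-products : Local (pairs n) (λ s → [ level s ] * (2 * (x s * y s)))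
    local-products s≐t =
      cong₂ (λ l p → [ l ] * p) (local-level s≐t) (cong (2 *_) (cong₂ _*_ (local-x s≐t) (local-y s≐t)))
    local-squares : Local (pairs n) (λ s → [ level s ] * (x s * x s + y s * y s))
    local-squares s≐t = cong₂ (λ l p → [ l ] * p) (local-level s≐t)
      (cong₂ _+_ (cong₂ _*_ (local-x s≐t) (local-x s≐t)) (cong₂ _*_ (local-y s≐t) (local-y s≐t)))

  proportional-mono : ∀ {k i} → k ≤ i → Proportional k → Proportional i
  proportional-mono {k} {i} k≤i prop-k r |r|+i≡m =
    *-cancelˡ-≡ _ _ (i C (i ∸ k)) {{>-nonZero (C-positive (m∸n≤m i k))}} (begin
      (i C (i ∸ k)) * x r
        ≡⟨ sym (*-copiesAbove-lift k b G r |r|+i≡m k≤i) ⟩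
      ∑[ s ⊆ pairs n ] [ ∣ s ∣ + k ≡ᵇ m ] * ([ r ⊆ᵉ s ] * x s)
        ≡⟨ ∑-cong (pairs n) (λ s → []*-cong (∣ s ∣ + k ≡ᵇ m) λ |s|+k≡ᵇm →
                                     cong ([ r ⊆ᵉ s ] *_) (prop-k s (≡ᵇ-≡ |s|+k≡ᵇm))) ⟩
      ∑[ s ⊆ pairs n ] [ ∣ s ∣ + k ≡ᵇ m ] * ([ r ⊆ᵉ s ] * y s)
        ≡⟨ *-copiesAbove-lift k a H r |r|+i≡m k≤i ⟩
      (i C (i ∸ k)) * y r ∎)
    where open ≡-Reasoning

  proportional⇒vanishing : ∀ {i} → Proportional i → VanishesOn m (ΔX i G H)
  proportional⇒vanishing {i} prop-i K _ =
    ≡-trans (cong (λ d → ℤ.+ Δentry i K G ℤ.- ℤ.+ d) (sym ΔKG≡ΔKH)) (ℤ.+-inverseʳ (ℤ.+ Δentry i K G))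
    where
    open ≡-Reasoning
    ab>0 : 0 < a * b
    ab>0 = *-mono-≤ (copies-positive {G = G} eG) (copies-positive {G = H} eH)
    ΔKG≡ΔKH : Δentry i K G ≡ Δentry i K H
    ΔKG≡ΔKH = *-cancelˡ-≡ _ _ (a * b) {{>-nonZero ab>0}} (begin
      (a * b) * Δentry i K G
        ≡⟨ ≡-trans (cong (_* Δentry i K G) (*-comm a b)) (*-assoc b a _) ⟩
      b * (a * Δentry i K G)
        ≡⟨ cong (b *_) (sym (overlaps≡copies*Δentry i K eG)) ⟩
      b * overlaps i m G K
        ≡⟨ sym (*-distribˡ-∑ (pairs n) b _) ⟩
      ∑[ s ⊆ pairs n ] b * ([ ∣ s ∣ + i ≡ᵇ m ] * (copiesAbove m G s * copiesAbove m K s))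
        ≡⟨ ∑-cong (pairs n) (λ s → regroup b [ ∣ s ∣ + i ≡ᵇ m ] (copiesAbove m G s) (copiesAbove m K s)) ⟩
      ∑[ s ⊆ pairs n ] [ ∣ s ∣ + i ≡ᵇ m ] * (x s * copiesAbove m K s)
        ≡⟨ ∑-cong (pairs n) (λ s → []*-cong (∣ s ∣ + i ≡ᵇ m) λ |s|+i≡ᵇm →
                                     cong (_* copiesAbove m K s) (prop-i s (≡ᵇ-≡ |s|+i≡ᵇm))) ⟩
      ∑[ s ⊆ pairs n ] [ ∣ s ∣ + i ≡ᵇ m ] * (y s * copiesAbove m K s)
        ≡⟨ ∑-cong (pairs n) (λ s →
             sym (regroup a [ ∣ s ∣ + i ≡ᵇ m ] (copiesAbove m H s) (copiesAbove m K s))) ⟩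
      ∑[ s ⊆ pairs n ] a * ([ ∣ s ∣ + i ≡ᵇ m ] * (copiesAbove m H s * copiesAbove m K s))
        ≡⟨ *-distribˡ-∑ (pairs n) a _ ⟩
      a * overlaps i m H K
        ≡⟨ cong (a *_) (overlaps≡copies*Δentry i K eH) ⟩
      a * (b * Δentry i K H)
        ≡⟨ sym (*-assoc a b _) ⟩
      (a * b) * Δentry i K H ∎)
      where
      regroup : ∀ c l p q → c * (l * (p * q)) ≡ l * ((c * p) * q)
      regroup = solve-∀

corollary2p4 : (n m : ℕ) → 1 ≤ n → m ≤ n C 2 →
    (G H : Graph n) → numEdges G ≡ m → numEdges H ≡ m →
    (k : ℕ) → VanishesOn m (ΔX k G H) →
    (i : ℕ) → k ≤ i → VanishesOn m (ΔX i G H)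
corollary2p4 n m _ _ G H eG eH k Δk≡0 i k≤i =
  proportional⇒vanishing eG eH (proportional-mono eG eH k≤i (vanishing⇒proportional eG eH k Δk≡0))
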